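{- Let $m\in\{3,4,6\}$ and let $p$ be a prime greater than $3$. Then for any $t\in D_p$, modulo $p$: \begin{align*} \sum_{k=0}^{p-1}\frac{\left(\frac{1}{m}\right)_k\left(\frac{m-1}{m}\right)_k}{(2k+1)!}\,t^k&\equiv \frac{1}{m(1+2\lfloor p/m\rfloor)}\Bigl((m-1)w_{\lfloor p/m\rfloor}(1-t/2)-w_{\lfloor (m-1)p/m\rfloor}(1-t/2)\Bigr),\\ \sum_{k=0}^{p-1}\frac{\left(\frac{1}{m}\right)_k\left(\frac{m-1}{m}\right)_k}{(2k)!}\, t^k&\equiv \frac{(-1)^{\lfloor p/m\rfloor}}{m}\Bigl((m-1)w_{\lfloor p/m\rfloor}(t/2-1)+w_{\lfloor (m-1)p/m\rfloor}(t/2-1)\Bigr). \end{align*}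
   Context: $(a)_k=a(a+1)\cdots(a+k-1)$ is the Pochhammer symbol ($(a)_0=1$). The polynomials $w_n(x)$ are defined by $w_0(x)=1$, $w_1(x)=1+2x$, $w_{n+1}(x)=2xw_n(x)-w_{n-1}(x)$. $D_p$ is the set of rationals whose denominator is not divisible by the prime $p$; congruences between elements of $D_p$ are taken in the usual sense (numerator of the difference divisible by $p$). -}

module Defs where

open import Data.Nat as ℕ using (ℕ; zero; suc)
open import Data.Nat.Divisibility using (_∣_)
open import Data.Integer as ℤ using (ℤ; +_)
open import Data.Rational as ℚ using (ℚ; _+_; _*_; _-_; 0ℚ; 1ℚ; -_)

-- the rational 1/n for n ≥ 1 (1/0 is set to 0; never used at 0 below)
recipℕ : ℕ → ℚ
recipℕ zero = 0ℚ
recipℕ (suc n) = (+ 1) ℚ./ suc n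

fromℕ : ℕ → ℚ
fromℕ n = (+ n) ℚ./ 1

poch : ℚ → ℕ → ℚ
poch a zero = 1ℚ
poch a (suc k) = poch a k * (a + fromℕ k)

w : ℕ → ℚ → ℚ
w zero x = 1ℚ
w (suc zero) x = 1ℚ + fromℕ 2 * x
w (suc (suc n)) x = fromℕ 2 * x * w (suc n) x - w n x

Σ< : ℕ → (ℕ → ℚ) → ℚ
Σ< zero f = 0ℚ
Σ< (suc n) f = Σ< n f + f n

signPow : ℕ → ℚ
signPow zero = 1ℚ
signPow (suc n) = - signPow n

powℚ : ℚ → ℕ → ℚ
powℚ t zero = 1ℚ
powℚ t (suc n) = powℚ t n * t

-- D_p : denominator (in lowest terms) not divisible by p
InDp : ℕ → ℚ → Set
InDp p t = (p ∣ ℚ.denominatorℕ t) → ⊥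
  where open import Data.Empty using (⊥)

-- x ≡ y (mod p): numerator (in lowest terms) of x - y divisible by p
_≡_[modℚ_] : ℚ → ℚ → ℕ → Set
x ≡ y [modℚ p ] = p ∣ ℤ.∣ ℚ.numerator (x - y) ∣

-- Write Q s k = ∏_{j<k} (j(j+1) + s). Since (a)_k (b)_k = Q (ab) k when a + b = 1, both sums are
-- Σ_{k<p} Q(ab, k) t^k / j(k)! with j(k) = 2k+1 resp. 2k. The coefficients of w_n are binomial coefficients
-- satisfying Pascal-type recurrences, which gives w_n(1 − t/2) = (2n+1) Σ_k Q(−n(n+1), k) t^k / (2k+1)! and
-- w_n(t/2 − 1) = (−1)^n Σ_k Q(−n(n+1), k) t^k / (2k)!. So it suffices to compare the series for
-- s = ab, −n(n+1), −N(N+1), where n = ⌊p/m⌋, N = ⌊(m−1)p/m⌋ and n + N = p − 1. Because p ≡ ±1 (mod m),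
-- n(n+1) + ab = p e₀ with e₀ p-integral, while n(n+1) − N(N+1) = p (n − N). For k ≤ n the three products
-- agree mod p and j(k)! is prime to p. For n < k < p the product for −n(n+1) vanishes, the other two carry
-- the factors p e₀ and p (n − N), which absorb the single factor p of j(k)!, and m e₀ ≡ n − N (mod p)
-- makes the quotients agree.

module Submission where

open import Defs
open import Data.Empty using (⊥-elim)
open import Data.Integer using (+_)
import Data.Integer as ℤ
open import Data.Integer.Divisibility.Signed using (∣ᵤ⇒∣; ∣⇒∣ᵤ; ∣m∣n⇒∣m+n; ∣m⇒∣m*n)
open import Data.Integer.GCD using () renaming (gcd to ℤgcd)
import Data.Integer.Properties as ℤₚ
import Data.Integer.Tactic.RingSolver as ℤ-Solver
open import Data.Maybe.Base using (Maybe; just; nothing)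
open import Data.Nat as ℕ using (ℕ; zero; suc; _≤_; _<_; _>_; _∸_; _!; z≤n; s≤s; NonZero)
open import Data.Nat.Combinatorics using (_C_; _P_; nCk≡nPk/k!; k>n⇒nCk≡0; nC1≡n; nCk+nC[k+1]≡[n+1]C[k+1])
open import Data.Nat.Combinatorics.Base using (_P′_)
open import Data.Nat.Combinatorics.Specification using (nPk≡n!/[n∸k]!; nP′k≡n!/[n∸k]!; k!∣nP′k; nP′k≡n[n∸1P′k∸1])
open import Data.Nat.Coprimality using (coprime?)
open import Data.Nat.Divisibility
  using (_∣_; divides; ∣-trans; ∣-refl; _∣0; ∣1⇒≡1; >⇒∤; ∣m+n∣m⇒∣n; n∣m*n; m%n≡0⇒n∣m; ∣n∣m%n⇒∣m)
open import Data.Nat.DivMod using (_%_; m/n*n≡m; m*n/n≡m; m<n⇒m/n≡0; +-distrib-/-∣ʳ; m≡m%n+[m/n]*n; m%n<n)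
open import Data.Nat.GCD using (gcd[m,n]∣n)
open import Data.Nat.Primality using (Prime; euclidsLemma; prime⇒nonTrivial; prime⇒nonZero; composite)
import Data.Nat.Properties as ℕₚ
open import Data.Nat.Properties using (_!≢0)
import Data.Nat.Tactic.RingSolver as ℕ-Solver
open import Data.Product using (_×_; _,_; ∃-syntax)
open import Data.Rational as ℚ using (ℚ; mkℚ; ↥_; ↧_; ↧ₙ_; _+_; _*_; _-_; -_; 0ℚ; 1ℚ)
import Data.Rational.Properties as ℚₚ
import Data.Rational.Unnormalised as ℚᵘ
import Data.Rational.Unnormalised.Properties as ℚᵘₚ
open import Data.Sum using (_⊎_; inj₁; inj₂; [_,_]′)
open import Level using (0ℓ)
open import Relation.Binary.Bundles using (Setoid)
open import Relation.Binary.PropositionalEquality using (_≡_; refl; sym; trans; cong; cong₂; subst; subst₂; module ≡-Reasoning)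
import Relation.Binary.Reasoning.Setoid
open import Relation.Nullary using (¬_; yes; no)
open import Relation.Nullary.Decidable using (recompute)
open import Tactic.RingSolver using (solve-∀)
open import Tactic.RingSolver.Core.AlmostCommutativeRing using (AlmostCommutativeRing; fromCommutativeRing)

ℚ-ring : AlmostCommutativeRing 0ℓ 0ℓ
ℚ-ring = fromCommutativeRing ℚₚ.+-*-commutativeRing is-zero
  where
  is-zero : ∀ x → Maybe (0ℚ ≡ x)
  is-zero x with 0ℚ ℚₚ.≟ x
  ... | yes e = just e
  ... | no _ = nothing

-- Identities that hold only under a relation u = 1 (or u = 0) are checked by the ring solver
-- in the form x = y + (1 − u) z (resp. x = y + u z).
substitute-one : ∀ {u} → u ≡ 1ℚ → ∀ {x y} z → x ≡ y + (1ℚ - u) * z → x ≡ y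
substitute-one {u} refl {x} {y} z x≡ = trans x≡ (vanish y z)
  where
  vanish : ∀ y z → y + (1ℚ - 1ℚ) * z ≡ y
  vanish = solve-∀ ℚ-ring

substitute-zero : ∀ {u} → u ≡ 0ℚ → ∀ {x y} z → x ≡ y + u * z → x ≡ y
substitute-zero {u} refl {x} {y} z x≡ = trans x≡ (vanish y z)
  where
  vanish : ∀ y z → y + 0ℚ * z ≡ y
  vanish = solve-∀ ℚ-ring

2*suc : ∀ k → 2 ℕ.* suc k ≡ suc (suc (2 ℕ.* k))
2*suc = ℕ-Solver.solve-∀

n<k⇒n+k<2k : ∀ {n k} → n < k → n ℕ.+ k < 2 ℕ.* k
n<k⇒n+k<2k {n} {k} n<k = subst (n ℕ.+ k <_) (cong (k ℕ.+_) (sym (ℕₚ.+-identityʳ k))) (ℕₚ.+-monoˡ-< k n<k)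

2k+1<m+m : ∀ {k m} → k < m → suc (2 ℕ.* k) < m ℕ.+ m
2k+1<m+m {k} {m} k<m = subst (_≤ m ℕ.+ m) (2[k+1]≡ k) (ℕₚ.+-mono-≤ k<m k<m)
  where
  2[k+1]≡ : ∀ k → suc k ℕ.+ suc k ≡ suc (suc (2 ℕ.* k))
  2[k+1]≡ = ℕ-Solver.solve-∀

∸-*-vanishing : ∀ n k f → (n < k → f ≡ 0) → (n ∸ k) ℕ.* f ℕ.+ k ℕ.* f ≡ n ℕ.* f
∸-*-vanishing n k f f≡0 with k ℕₚ.≤? n
... | yes k≤n = trans (sym (ℕₚ.*-distribʳ-+ f (n ∸ k) k)) (cong (ℕ._* f) (ℕₚ.m∸n+n≡m k≤n))
... | no k≰n rewrite f≡0 (ℕₚ.≰⇒> k≰n) = trans (cong₂ ℕ._+_ (ℕₚ.*-zeroʳ (n ∸ k)) (ℕₚ.*-zeroʳ k)) (sym (ℕₚ.*-zeroʳ n))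

n!≡n*[n-1]! : ∀ n .{{_ : NonZero n}} → n ! ≡ n ℕ.* (ℕ.pred n) !
n!≡n*[n-1]! (suc n) = refl

pred[n]<n : ∀ n .{{_ : NonZero n}} → ℕ.pred n < n
pred[n]<n (suc n) = ℕₚ.n<1+n n

[r+q*m]/m≡q : ∀ r q m .{{_ : NonZero m}} → r < m → (r ℕ.+ q ℕ.* m) ℕ./ m ≡ q
[r+q*m]/m≡q r q m r<m = trans (+-distrib-/-∣ʳ r (n∣m*n q)) (cong₂ ℕ._+_ (m<n⇒m/n≡0 r<m) (m*n/n≡m q m))

floor-sum : ∀ p m .{{_ : NonZero m}} → ¬ p % m ≡ 0 → suc (p ℕ./ m ℕ.+ (m ∸ 1) ℕ.* p ℕ./ m) ≡ p
floor-sum p m@(suc μ) r≢0 = begin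
  suc (p ℕ./ m ℕ.+ μ ℕ.* p ℕ./ m)                           ≡⟨ cong (λ x → suc (p ℕ./ m ℕ.+ μ ℕ.* x ℕ./ m)) p≡ ⟩
  suc (p ℕ./ m ℕ.+ μ ℕ.* (p % m ℕ.+ p ℕ./ m ℕ.* m) ℕ./ m)   ≡⟨ floor-sum′ (p % m) (p ℕ./ m) (m%n<n p m) r≢0 ⟩
  p % m ℕ.+ p ℕ./ m ℕ.* m                                   ≡⟨ sym p≡ ⟩
  p                                                         ∎
  where
  open ≡-Reasoning
  p≡ : p ≡ p % m ℕ.+ p ℕ./ m ℕ.* m
  p≡ = m≡m%n+[m/n]*n p m
  floor-sum′ : ∀ r n → r < m → ¬ r ≡ 0 → suc (n ℕ.+ μ ℕ.* (r ℕ.+ n ℕ.* m) ℕ./ m) ≡ r ℕ.+ n ℕ.* m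
  floor-sum′ zero n _ r≢0 = ⊥-elim (r≢0 refl)
  floor-sum′ (suc r′) n (s≤s r′<μ) _ = begin
    suc (n ℕ.+ μ ℕ.* (suc r′ ℕ.+ n ℕ.* m) ℕ./ m)            ≡⟨ cong (λ x → suc (n ℕ.+ x ℕ./ m)) split ⟩
    suc (n ℕ.+ (d ℕ.+ (r′ ℕ.+ μ ℕ.* n) ℕ.* m) ℕ./ m)
      ≡⟨ cong (λ x → suc (n ℕ.+ x)) ([r+q*m]/m≡q d (r′ ℕ.+ μ ℕ.* n) m (s≤s (ℕₚ.m∸n≤m μ r′))) ⟩
    suc (n ℕ.+ (r′ ℕ.+ μ ℕ.* n))                           ≡⟨ collect n r′ μ ⟩
    suc r′ ℕ.+ n ℕ.* m                                     ∎
    where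
    d = μ ∸ r′
    expand : ∀ d r′ n → (d ℕ.+ r′) ℕ.* (suc r′ ℕ.+ n ℕ.* suc (d ℕ.+ r′))
                        ≡ d ℕ.+ (r′ ℕ.+ (d ℕ.+ r′) ℕ.* n) ℕ.* suc (d ℕ.+ r′)
    expand = ℕ-Solver.solve-∀
    split : μ ℕ.* (suc r′ ℕ.+ n ℕ.* m) ≡ d ℕ.+ (r′ ℕ.+ μ ℕ.* n) ℕ.* m
    split = subst (λ μ → μ ℕ.* (suc r′ ℕ.+ n ℕ.* suc μ) ≡ d ℕ.+ (r′ ℕ.+ μ ℕ.* n) ℕ.* suc μ)
                  (ℕₚ.m∸n+n≡m (ℕₚ.<⇒≤ r′<μ)) (expand d r′ n)
    collect : ∀ n r′ μ → suc (n ℕ.+ (r′ ℕ.+ μ ℕ.* n)) ≡ suc r′ ℕ.+ n ℕ.* suc μ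
    collect = ℕ-Solver.solve-∀

2[p/m]+1<p : ∀ p m .{{_ : NonZero m}} → 3 ≤ m → 1 < p → ¬ p % m ≡ 0 → suc (2 ℕ.* (p ℕ./ m)) < p
2[p/m]+1<p p m 3≤m 1<p r≢0 with p ℕ./ m | m≡m%n+[m/n]*n p m
... | zero | _ = 1<p
... | suc n′ | p≡ = subst (suc (2 ℕ.* suc n′) <_) (sym p≡) (bound (p % m) r≢0)
  where
  bound : ∀ r → ¬ r ≡ 0 → suc (2 ℕ.* suc n′) < r ℕ.+ suc n′ ℕ.* m
  bound zero r≢0 = ⊥-elim (r≢0 refl)
  bound (suc r′) _ = ℕₚ.≤-trans (subst (suc (suc (2 ℕ.* suc n′)) ≤_) (sym (count n′)) (ℕₚ.m≤m+n _ n′))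
                                (ℕₚ.+-mono-≤ (s≤s (z≤n {r′})) (ℕₚ.*-monoʳ-≤ (suc n′) 3≤m))
    where
    count : ∀ n′ → 1 ℕ.+ suc n′ ℕ.* 3 ≡ suc (suc (2 ℕ.* suc n′)) ℕ.+ n′
    count = ℕ-Solver.solve-∀

fromℕ-toℚᵘ : ∀ n → ℚ.toℚᵘ (fromℕ n) ℚᵘ.≃ ℚᵘ.mkℚᵘ (+ n) 0
fromℕ-toℚᵘ n = ℚₚ.toℚᵘ-fromℚᵘ (ℚᵘ.mkℚᵘ (+ n) 0)

recipℕ-toℚᵘ : ∀ d → ℚ.toℚᵘ (recipℕ (suc d)) ℚᵘ.≃ ℚᵘ.mkℚᵘ (+ 1) d
recipℕ-toℚᵘ d = ℚₚ.toℚᵘ-fromℚᵘ (ℚᵘ.mkℚᵘ (+ 1) d)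

fromℕ-+ : ∀ m n → fromℕ (m ℕ.+ n) ≡ fromℕ m + fromℕ n
fromℕ-+ m n = ℚₚ.toℚᵘ-injective (ℚᵘₚ.≃-trans (fromℕ-toℚᵘ (m ℕ.+ n)) (ℚᵘₚ.≃-sym
  (ℚᵘₚ.≃-trans (ℚₚ.toℚᵘ-homo-+ (fromℕ m) (fromℕ n))
    (ℚᵘₚ.≃-trans (ℚᵘₚ.+-cong (fromℕ-toℚᵘ m) (fromℕ-toℚᵘ n)) (ℚᵘ.*≡* (same (+ m) (+ n)))))))
  where
  same : ∀ i j → (i ℤ.* ℤ.1ℤ ℤ.+ j ℤ.* ℤ.1ℤ) ℤ.* ℤ.1ℤ ≡ (i ℤ.+ j) ℤ.* ℤ.1ℤ
  same = ℤ-Solver.solve-∀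

fromℕ-* : ∀ m n → fromℕ (m ℕ.* n) ≡ fromℕ m * fromℕ n
fromℕ-* m n = ℚₚ.toℚᵘ-injective (ℚᵘₚ.≃-trans (fromℕ-toℚᵘ (m ℕ.* n)) (ℚᵘₚ.≃-sym
  (ℚᵘₚ.≃-trans (ℚₚ.toℚᵘ-homo-* (fromℕ m) (fromℕ n))
    (ℚᵘₚ.≃-trans (ℚᵘₚ.*-cong (fromℕ-toℚᵘ m) (fromℕ-toℚᵘ n))
      (ℚᵘ.*≡* (cong (ℤ._* ℤ.1ℤ) (sym (ℤₚ.pos-* m n))))))))

fromℕ-pronic : ∀ n → fromℕ (n ℕ.* suc n) ≡ fromℕ n * (1ℚ + fromℕ n)
fromℕ-pronic n = trans (fromℕ-* n (suc n)) (cong (fromℕ n *_) (fromℕ-+ 1 n))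

fromℕ-recurrence : ∀ a b c d → a ℕ.+ c ≡ 2 ℕ.* b ℕ.+ d → fromℕ a ≡ fromℕ 2 * fromℕ b + fromℕ d - fromℕ c
fromℕ-recurrence a b c d a+c≡ = begin
  fromℕ a                              ≡⟨ add-sub (fromℕ a) (fromℕ c) ⟩
  (fromℕ a + fromℕ c) - fromℕ c        ≡⟨ cong (_- fromℕ c) (sym (fromℕ-+ a c)) ⟩
  fromℕ (a ℕ.+ c) - fromℕ c            ≡⟨ cong (λ x → fromℕ x - fromℕ c) a+c≡ ⟩
  fromℕ (2 ℕ.* b ℕ.+ d) - fromℕ c      ≡⟨ cong (_- fromℕ c) (trans (fromℕ-+ (2 ℕ.* b) d) (cong (_+ fromℕ d) (fromℕ-* 2 b))) ⟩
  fromℕ 2 * fromℕ b + fromℕ d - fromℕ c  ∎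
  where
  open ≡-Reasoning
  add-sub : ∀ x y → x ≡ (x + y) - y
  add-sub = solve-∀ ℚ-ring

fromℕ-∸-* : ∀ n k f → (n < k → f ≡ 0) → fromℕ ((n ∸ k) ℕ.* f) ≡ (fromℕ n - fromℕ k) * fromℕ f
fromℕ-∸-* n k f f≡0 = begin
  fromℕ x                                  ≡⟨ add-sub (fromℕ x) (fromℕ y) ⟩
  fromℕ x + fromℕ y - fromℕ y              ≡⟨ cong (_- fromℕ y) (sym (fromℕ-+ x y)) ⟩
  fromℕ (x ℕ.+ y) - fromℕ y                ≡⟨ cong (λ u → fromℕ u - fromℕ y) (∸-*-vanishing n k f f≡0) ⟩
  fromℕ (n ℕ.* f) - fromℕ y                ≡⟨ cong₂ _-_ (fromℕ-* n f) (fromℕ-* k f) ⟩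
  fromℕ n * fromℕ f - fromℕ k * fromℕ f    ≡⟨ factor-out (fromℕ n) (fromℕ k) (fromℕ f) ⟩
  (fromℕ n - fromℕ k) * fromℕ f            ∎
  where
  open ≡-Reasoning
  x = (n ∸ k) ℕ.* f
  y = k ℕ.* f
  add-sub : ∀ x y → x ≡ x + y - y
  add-sub = solve-∀ ℚ-ring
  factor-out : ∀ x y z → x * z - y * z ≡ (x - y) * z
  factor-out = solve-∀ ℚ-ring

recipℕ-inverseˡ : ∀ n .{{_ : NonZero n}} → recipℕ n * fromℕ n ≡ 1ℚ
recipℕ-inverseˡ (suc d) = ℚₚ.toℚᵘ-injective (ℚᵘₚ.≃-trans (ℚₚ.toℚᵘ-homo-* (recipℕ (suc d)) (fromℕ (suc d)))
  (ℚᵘₚ.≃-trans (ℚᵘₚ.*-cong (recipℕ-toℚᵘ d) (fromℕ-toℚᵘ (suc d)))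
    (ℚᵘ.*≡* (trans (same (+ suc d)) (cong (ℤ.1ℤ ℤ.*_) (sym (ℤₚ.pos-* (suc d) 1)))))))
  where
  same : ∀ i → (ℤ.1ℤ ℤ.* i) ℤ.* ℤ.1ℤ ≡ ℤ.1ℤ ℤ.* (i ℤ.* ℤ.1ℤ)
  same = ℤ-Solver.solve-∀

inverse-unique : ∀ {x y f} → x * f ≡ 1ℚ → y * f ≡ 1ℚ → x ≡ y
inverse-unique {x} {y} {f} xf≡1 yf≡1 =
  substitute-one xf≡1 (- y) (substitute-one yf≡1 x (expand x y f))
  where
  expand : ∀ x y f → x ≡ (y + (1ℚ - x * f) * (- y)) + (1ℚ - y * f) * x
  expand = solve-∀ ℚ-ring

recipℕ-* : ∀ m n .{{_ : NonZero m}} .{{_ : NonZero n}} → recipℕ (m ℕ.* n) ≡ recipℕ m * recipℕ n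
recipℕ-* m n = inverse-unique (recipℕ-inverseˡ (m ℕ.* n) {{ℕₚ.m*n≢0 m n}}) (begin
  recipℕ m * recipℕ n * fromℕ (m ℕ.* n)             ≡⟨ cong (recipℕ m * recipℕ n *_) (fromℕ-* m n) ⟩
  recipℕ m * recipℕ n * (fromℕ m * fromℕ n)         ≡⟨ regroup (recipℕ m) (recipℕ n) (fromℕ m) (fromℕ n) ⟩
  (recipℕ m * fromℕ m) * (recipℕ n * fromℕ n)       ≡⟨ cong₂ _*_ (recipℕ-inverseˡ m) (recipℕ-inverseˡ n) ⟩
  1ℚ * 1ℚ                                           ≡⟨⟩
  1ℚ                                                ∎)
  where
  open ≡-Reasoning
  regroup : ∀ a b c d → a * b * (c * d) ≡ (a * c) * (b * d)
  regroup = solve-∀ ℚ-ring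

/≡fromℕ*recipℕ : ∀ k m .{{_ : NonZero m}} → (+ k) ℚ./ m ≡ fromℕ k * recipℕ m
/≡fromℕ*recipℕ k (suc d) = ℚₚ.toℚᵘ-injective (ℚᵘₚ.≃-trans (ℚₚ.toℚᵘ-fromℚᵘ (ℚᵘ.mkℚᵘ (+ k) d)) (ℚᵘₚ.≃-sym
  (ℚᵘₚ.≃-trans (ℚₚ.toℚᵘ-homo-* (fromℕ k) (recipℕ (suc d)))
    (ℚᵘₚ.≃-trans (ℚᵘₚ.*-cong (fromℕ-toℚᵘ k) (recipℕ-toℚᵘ d)) (ℚᵘ.*≡* (same (+ k) (+ suc d)))))))
  where
  same : ∀ i j → (i ℤ.* ℤ.1ℤ) ℤ.* j ≡ i ℤ.* (ℤ.1ℤ ℤ.* j)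
  same = ℤ-Solver.solve-∀

fromℕ-/ : ∀ a b K .{{_ : NonZero K}} → a ℕ.* K ≡ b → fromℕ a ≡ fromℕ b * recipℕ K
fromℕ-/ a b K a*K≡b = begin
  fromℕ a                        ≡⟨ substitute-one (recipℕ-inverseˡ K) (fromℕ a) (expand (fromℕ a) (recipℕ K) (fromℕ K)) ⟩
  fromℕ a * fromℕ K * recipℕ K   ≡⟨ cong (_* recipℕ K) (trans (sym (fromℕ-* a K)) (cong fromℕ a*K≡b)) ⟩
  fromℕ b * recipℕ K             ∎
  where
  open ≡-Reasoning
  expand : ∀ x r f → x ≡ x * f * r + (1ℚ - r * f) * x
  expand = solve-∀ ℚ-ring

halve : ∀ t → t * recipℕ 2 * fromℕ 2 ≡ t
halve t = trans (ℚₚ.*-assoc t (recipℕ 2) (fromℕ 2)) (trans (cong (t *_) (recipℕ-inverseˡ 2)) (ℚₚ.*-identityʳ t))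

Σ<-cong : ∀ L {f g} → (∀ k → k < L → f k ≡ g k) → Σ< L f ≡ Σ< L g
Σ<-cong zero f≡g = refl
Σ<-cong (suc L) f≡g = cong₂ _+_ (Σ<-cong L (λ k k<L → f≡g k (ℕₚ.m≤n⇒m≤1+n k<L))) (f≡g L ℕₚ.≤-refl)

Σ<-linear : ∀ L α β f g → Σ< L (λ k → α * f k + β * g k) ≡ α * Σ< L f + β * Σ< L g
Σ<-linear zero α β f g = empty α β
  where
  empty : ∀ α β → 0ℚ ≡ α * 0ℚ + β * 0ℚ
  empty = solve-∀ ℚ-ring
Σ<-linear (suc L) α β f g =
  trans (cong (_+ (α * f L + β * g L)) (Σ<-linear L α β f g)) (step α β (Σ< L f) (Σ< L g) (f L) (g L))
  where
  step : ∀ α β F G x y → (α * F + β * G) + (α * x + β * y) ≡ α * (F + x) + β * (G + y)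
  step = solve-∀ ℚ-ring

Σ<-- : ∀ L f g → Σ< L (λ k → f k - g k) ≡ Σ< L f - Σ< L g
Σ<-- L f g = trans (Σ<-cong L (λ k _ → as-linear (f k) (g k))) (trans (Σ<-linear L 1ℚ (- 1ℚ) f g) (sym (as-linear (Σ< L f) (Σ< L g))))
  where
  as-linear : ∀ x y → x - y ≡ 1ℚ * x + (- 1ℚ) * y
  as-linear = solve-∀ ℚ-ring

Σ<-*ˡ : ∀ L α f → Σ< L (λ k → α * f k) ≡ α * Σ< L f
Σ<-*ˡ zero α f = sym (ℚₚ.*-zeroʳ α)
Σ<-*ˡ (suc L) α f = trans (cong (_+ α * f L) (Σ<-*ˡ L α f)) (sym (ℚₚ.*-distribˡ-+ α (Σ< L f) (f L)))

Σ<-extend : ∀ L M f → L ≤ M → (∀ k → L ≤ k → f k ≡ 0ℚ) → Σ< M f ≡ Σ< L f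
Σ<-extend L zero f z≤n _ = refl
Σ<-extend L (suc M) f L≤1+M f≡0 with ℕₚ.m≤n⇒m<n∨m≡n L≤1+M
... | inj₂ refl = refl
... | inj₁ (s≤s L≤M) = trans (cong₂ _+_ (Σ<-extend L M f L≤M f≡0) (f≡0 M L≤M)) (ℚₚ.+-identityʳ (Σ< L f))

shift : (ℕ → ℚ) → ℕ → ℚ
shift g zero = 0ℚ
shift g (suc k) = g k

Σ<-shift : ∀ L g t → Σ< (suc L) (λ k → shift g k * powℚ t k) ≡ t * Σ< L (λ k → g k * powℚ t k)
Σ<-shift zero g t = empty t
  where
  empty : ∀ t → 0ℚ + 0ℚ * 1ℚ ≡ t * 0ℚ
  empty = solve-∀ ℚ-ring
Σ<-shift (suc L) g t =
  trans (cong (_+ g L * (powℚ t L * t)) (Σ<-shift L g t)) (step t (Σ< L (λ k → g k * powℚ t k)) (g L) (powℚ t L))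
  where
  step : ∀ t S x y → t * S + x * (y * t) ≡ t * (S + x * y)
  step = solve-∀ ℚ-ring

∏< : ℕ → (ℕ → ℚ) → ℚ
∏< zero f = 1ℚ
∏< (suc n) f = ∏< n f * f n

∏<-split : ∀ n d f → ∏< (suc n ℕ.+ d) f ≡ ∏< n f * f n * ∏< d (λ i → f (suc n ℕ.+ i))
∏<-split n zero f = trans (cong (λ k → ∏< k f) (ℕₚ.+-identityʳ (suc n))) (sym (ℚₚ.*-identityʳ (∏< (suc n) f)))
∏<-split n (suc d) f = begin
  ∏< (suc n ℕ.+ suc d) f                           ≡⟨ cong (λ k → ∏< k f) (ℕₚ.+-suc (suc n) d) ⟩
  ∏< (suc n ℕ.+ d) f * f (suc n ℕ.+ d)             ≡⟨ cong (_* f (suc n ℕ.+ d)) (∏<-split n d f) ⟩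
  ∏< n f * f n * ∏< d f′ * f′ d                    ≡⟨ ℚₚ.*-assoc (∏< n f * f n) (∏< d f′) (f′ d) ⟩
  ∏< n f * f n * (∏< d f′ * f′ d)                  ∎
  where
  open ≡-Reasoning
  f′ = λ i → f (suc n ℕ.+ i)

signPow-+ : ∀ m n → signPow (m ℕ.+ n) ≡ signPow m * signPow n
signPow-+ zero n = sym (ℚₚ.*-identityˡ (signPow n))
signPow-+ (suc m) n = trans (cong -_ (signPow-+ m n)) (ℚₚ.neg-distribˡ-* (signPow m) (signPow n))

signPow-square : ∀ n → signPow n * signPow n ≡ 1ℚ
signPow-square zero = refl
signPow-square (suc n) = trans (neg-square (signPow n)) (signPow-square n)
  where
  neg-square : ∀ x → (- x) * (- x) ≡ x * x
  neg-square = solve-∀ ℚ-ring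

signPow-even : ∀ n → signPow (n ℕ.+ n) ≡ 1ℚ
signPow-even n = trans (signPow-+ n n) (signPow-square n)

-- Binomial coefficients and falling factorials

P′-vanishes : ∀ {n k} → n < k → n P′ k ≡ 0
P′-vanishes {n} {suc k} (s≤s n≤k) with ℕₚ.m≤n⇒m<n∨m≡n n≤k
... | inj₁ n<k = trans (cong ((n ∸ k) ℕ.*_) (P′-vanishes n<k)) (ℕₚ.*-zeroʳ (n ∸ k))
... | inj₂ refl = cong (ℕ._* (n P′ n)) (ℕₚ.n∸n≡0 n)

C*!≡P′ : ∀ n k → (n C k) ℕ.* k ! ≡ n P′ k
C*!≡P′ n k with k ℕₚ.≤? n
... | yes k≤n = begin
  (n C k) ℕ.* k !              ≡⟨ cong (ℕ._* k !) (nCk≡nPk/k! k≤n) ⟩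
  ((n P k) ℕ./ k !) ℕ.* k !      ≡⟨ cong (λ x → (x ℕ./ k !) ℕ.* k !) (trans (nPk≡n!/[n∸k]! k≤n) (sym (nP′k≡n!/[n∸k]! k≤n))) ⟩
  ((n P′ k) ℕ./ k !) ℕ.* k !     ≡⟨ m/n*n≡m (k!∣nP′k k≤n) ⟩
  n P′ k                       ∎
  where
  open ≡-Reasoning
  instance _ = k !≢0
... | no k≰n = trans (cong (ℕ._* k !) (k>n⇒nCk≡0 (ℕₚ.≰⇒> k≰n))) (sym (P′-vanishes (ℕₚ.≰⇒> k≰n)))

C-second-difference : ∀ a c → suc (suc a) C suc (suc c) ℕ.+ a C suc (suc c) ≡ 2 ℕ.* (suc a C suc (suc c)) ℕ.+ a C c
C-second-difference a c = begin
  suc (suc a) C suc (suc c) ℕ.+ a C suc (suc c)  ≡⟨ cong (ℕ._+ a C suc (suc c)) (sym (nCk+nC[k+1]≡[n+1]C[k+1] (suc a) (suc c))) ⟩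
  (suc a C suc c ℕ.+ suc a C suc (suc c)) ℕ.+ a C suc (suc c)
    ≡⟨ cong₂ (λ x y → (x ℕ.+ y) ℕ.+ a C suc (suc c)) (sym (nCk+nC[k+1]≡[n+1]C[k+1] a c)) (sym (nCk+nC[k+1]≡[n+1]C[k+1] a (suc c))) ⟩
  (a C c ℕ.+ a C suc c ℕ.+ (a C suc c ℕ.+ a C suc (suc c))) ℕ.+ a C suc (suc c)
    ≡⟨ regroup (a C c) (a C suc c) (a C suc (suc c)) ⟩
  2 ℕ.* (a C suc c ℕ.+ a C suc (suc c)) ℕ.+ a C c
    ≡⟨ cong (λ x → 2 ℕ.* x ℕ.+ a C c) (nCk+nC[k+1]≡[n+1]C[k+1] a (suc c)) ⟩
  2 ℕ.* (suc a C suc (suc c)) ℕ.+ a C c  ∎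
  where
  open ≡-Reasoning
  regroup : ∀ x y z → (x ℕ.+ y ℕ.+ (y ℕ.+ z)) ℕ.+ z ≡ 2 ℕ.* (y ℕ.+ z) ℕ.+ x
  regroup = ℕ-Solver.solve-∀

C⁺ : ℕ → ℕ → ℕ
C⁺ a c = suc a C c ℕ.+ a C c

C⁺-second-difference : ∀ a c → C⁺ (suc (suc a)) (suc (suc c)) ℕ.+ C⁺ a (suc (suc c)) ≡ 2 ℕ.* C⁺ (suc a) (suc (suc c)) ℕ.+ C⁺ a c
C⁺-second-difference a c = begin
  (a₃ ℕ.+ a₂) ℕ.+ (a₁ ℕ.+ a₀)                         ≡⟨ interchange a₃ a₂ a₁ a₀ ⟩
  (a₃ ℕ.+ a₁) ℕ.+ (a₂ ℕ.+ a₀)                         ≡⟨ cong₂ ℕ._+_ (C-second-difference (suc a) c) (C-second-difference a c) ⟩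
  (2 ℕ.* a₂ ℕ.+ suc a C c) ℕ.+ (2 ℕ.* a₁ ℕ.+ a C c)   ≡⟨ collect a₂ a₁ (suc a C c) (a C c) ⟩
  2 ℕ.* (a₂ ℕ.+ a₁) ℕ.+ C⁺ a c                        ∎
  where
  open ≡-Reasoning
  a₃ = suc (suc (suc a)) C suc (suc c)
  a₂ = suc (suc a) C suc (suc c)
  a₁ = suc a C suc (suc c)
  a₀ = a C suc (suc c)
  interchange : ∀ w x y z → (w ℕ.+ x) ℕ.+ (y ℕ.+ z) ≡ (w ℕ.+ y) ℕ.+ (x ℕ.+ z)
  interchange = ℕ-Solver.solve-∀
  collect : ∀ x y u v → (2 ℕ.* x ℕ.+ u) ℕ.+ (2 ℕ.* y ℕ.+ v) ≡ 2 ℕ.* (x ℕ.+ y) ℕ.+ (u ℕ.+ v)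
  collect = ℕ-Solver.solve-∀

oddCoeff : ℕ → ℕ → ℕ
oddCoeff n k = C⁺ (n ℕ.+ k) (suc (2 ℕ.* k))

evenCoeff : ℕ → ℕ → ℕ
evenCoeff n k = (n ℕ.+ k) C (2 ℕ.* k)

oddCoeff-rec : ∀ n k → oddCoeff (suc (suc n)) (suc k) ℕ.+ oddCoeff n (suc k) ≡ 2 ℕ.* oddCoeff (suc n) (suc k) ℕ.+ oddCoeff (suc n) k
oddCoeff-rec n k = subst₂ (λ i j → C⁺ (suc (suc i)) j ℕ.+ C⁺ i j ≡ 2 ℕ.* C⁺ (suc i) j ℕ.+ oddCoeff (suc n) k)
  (sym (ℕₚ.+-suc n k)) (sym (cong suc (2*suc k))) (C⁺-second-difference (suc (n ℕ.+ k)) (suc (2 ℕ.* k)))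

evenCoeff-rec : ∀ n k → evenCoeff (suc (suc n)) (suc k) ℕ.+ evenCoeff n (suc k) ≡ 2 ℕ.* evenCoeff (suc n) (suc k) ℕ.+ evenCoeff (suc n) k
evenCoeff-rec n k = subst₂ (λ i j → suc (suc i) C j ℕ.+ i C j ≡ 2 ℕ.* (suc i C j) ℕ.+ evenCoeff (suc n) k)
  (sym (ℕₚ.+-suc n k)) (sym (2*suc k)) (C-second-difference (suc (n ℕ.+ k)) (2 ℕ.* k))

oddCoeff-rec₀ : ∀ n → oddCoeff (suc (suc n)) 0 ℕ.+ oddCoeff n 0 ≡ 2 ℕ.* oddCoeff (suc n) 0 ℕ.+ 0
oddCoeff-rec₀ n = begin
  oddCoeff (suc (suc n)) 0 ℕ.+ oddCoeff n 0         ≡⟨ cong₂ ℕ._+_ (oddCoeff-0 (suc (suc n))) (oddCoeff-0 n) ⟩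
  suc (2 ℕ.* suc (suc n)) ℕ.+ suc (2 ℕ.* n)         ≡⟨ count n ⟩
  2 ℕ.* suc (2 ℕ.* suc n) ℕ.+ 0                     ≡⟨ cong (λ x → 2 ℕ.* x ℕ.+ 0) (oddCoeff-0 (suc n)) ⟨
  2 ℕ.* oddCoeff (suc n) 0 ℕ.+ 0                    ∎
  where
  open ≡-Reasoning
  oddCoeff-0 : ∀ n → oddCoeff n 0 ≡ suc (2 ℕ.* n)
  oddCoeff-0 n = trans (cong₂ ℕ._+_ (nC1≡n (suc (n ℕ.+ 0))) (nC1≡n (n ℕ.+ 0))) (double n)
    where
    double : ∀ n → suc (n ℕ.+ 0) ℕ.+ (n ℕ.+ 0) ≡ suc (2 ℕ.* n)
    double = ℕ-Solver.solve-∀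
  count : ∀ n → suc (2 ℕ.* suc (suc n)) ℕ.+ suc (2 ℕ.* n) ≡ 2 ℕ.* suc (2 ℕ.* suc n) ℕ.+ 0
  count = ℕ-Solver.solve-∀

oddCoeff-vanishes : ∀ n k → n < k → oddCoeff n k ≡ 0
oddCoeff-vanishes n k n<k = cong₂ ℕ._+_ (k>n⇒nCk≡0 (s≤s (n<k⇒n+k<2k n<k))) (k>n⇒nCk≡0 (ℕₚ.m<n⇒m<1+n (n<k⇒n+k<2k n<k)))

evenCoeff-vanishes : ∀ n k → n < k → evenCoeff n k ≡ 0
evenCoeff-vanishes n k n<k = k>n⇒nCk≡0 (n<k⇒n+k<2k n<k)

fall : ℕ → ℕ → ℕ
fall n k = (n ℕ.+ k) P′ (2 ℕ.* k)

n+k∸2k≡n∸k : ∀ n k → (n ℕ.+ k) ∸ 2 ℕ.* k ≡ n ∸ k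
n+k∸2k≡n∸k n k = trans (cong₂ _∸_ (ℕₚ.+-comm n k) (cong (k ℕ.+_) (ℕₚ.+-identityʳ k))) (ℕₚ.[m+n]∸[m+o]≡n∸o k n k)

fall-suc : ∀ n k → fall n (suc k) ≡ (n ∸ k) ℕ.* (suc (n ℕ.+ k) ℕ.* fall n k)
fall-suc n k = begin
  (n ℕ.+ suc k) P′ (2 ℕ.* suc k)                                  ≡⟨ cong₂ _P′_ (ℕₚ.+-suc n k) (2*suc k) ⟩
  suc (n ℕ.+ k) P′ suc (suc (2 ℕ.* k))                            ≡⟨⟩
  ((n ℕ.+ k) ∸ 2 ℕ.* k) ℕ.* (suc (n ℕ.+ k) P′ suc (2 ℕ.* k))
    ≡⟨ cong₂ ℕ._*_ (n+k∸2k≡n∸k n k) (nP′k≡n[n∸1P′k∸1] (suc (n ℕ.+ k)) (suc (2 ℕ.* k))) ⟩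
  (n ∸ k) ℕ.* (suc (n ℕ.+ k) ℕ.* fall n k)                         ∎
  where open ≡-Reasoning

fall-vanishes : ∀ {n k} → n < k → fall n k ≡ 0
fall-vanishes n<k = P′-vanishes (n<k⇒n+k<2k n<k)

oddCoeff-closed : ∀ n k → oddCoeff n k ℕ.* (suc (2 ℕ.* k)) ! ≡ suc (2 ℕ.* n) ℕ.* fall n k
oddCoeff-closed n k = ℕₚ.+-cancelʳ-≡ (k ℕ.* f) _ _ (begin
  oddCoeff n k ℕ.* K ℕ.+ k ℕ.* f
    ≡⟨ cong (ℕ._+ k ℕ.* f) (ℕₚ.*-distribʳ-+ K (suc (n ℕ.+ k) C suc (2 ℕ.* k)) ((n ℕ.+ k) C suc (2 ℕ.* k))) ⟩
  (suc (n ℕ.+ k) C suc (2 ℕ.* k)) ℕ.* K ℕ.+ ((n ℕ.+ k) C suc (2 ℕ.* k)) ℕ.* K ℕ.+ k ℕ.* f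
    ≡⟨ cong₂ (λ x y → x ℕ.+ y ℕ.+ k ℕ.* f) (C*!≡P′ (suc (n ℕ.+ k)) (suc (2 ℕ.* k))) (C*!≡P′ (n ℕ.+ k) (suc (2 ℕ.* k))) ⟩
  suc (n ℕ.+ k) P′ suc (2 ℕ.* k) ℕ.+ ((n ℕ.+ k) ∸ 2 ℕ.* k) ℕ.* f ℕ.+ k ℕ.* f
    ≡⟨ cong₂ (λ x y → x ℕ.+ y ℕ.* f ℕ.+ k ℕ.* f) (nP′k≡n[n∸1P′k∸1] (suc (n ℕ.+ k)) (suc (2 ℕ.* k))) (n+k∸2k≡n∸k n k) ⟩
  suc (n ℕ.+ k) ℕ.* f ℕ.+ (n ∸ k) ℕ.* f ℕ.+ k ℕ.* f
    ≡⟨ ℕₚ.+-assoc (suc (n ℕ.+ k) ℕ.* f) ((n ∸ k) ℕ.* f) (k ℕ.* f) ⟩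
  suc (n ℕ.+ k) ℕ.* f ℕ.+ ((n ∸ k) ℕ.* f ℕ.+ k ℕ.* f)
    ≡⟨ cong (suc (n ℕ.+ k) ℕ.* f ℕ.+_) (∸-*-vanishing n k f fall-vanishes) ⟩
  suc (n ℕ.+ k) ℕ.* f ℕ.+ n ℕ.* f
    ≡⟨ regroup n k f ⟩
  suc (2 ℕ.* n) ℕ.* f ℕ.+ k ℕ.* f  ∎)
  where
  open ≡-Reasoning
  K = (suc (2 ℕ.* k)) !
  f = fall n k
  regroup : ∀ n k f → suc (n ℕ.+ k) ℕ.* f ℕ.+ n ℕ.* f ≡ suc (2 ℕ.* n) ℕ.* f ℕ.+ k ℕ.* f
  regroup = ℕ-Solver.solve-∀

-- The products Q s k

factor : ℚ → ℕ → ℚ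
factor s j = fromℕ (j ℕ.* suc j) + s

Q : ℚ → ℕ → ℚ
Q s k = ∏< k (factor s)

σ : ℕ → ℚ
σ n = - fromℕ (n ℕ.* suc n)

fall≡signPow*Q : ∀ n k → fromℕ (fall n k) ≡ signPow k * Q (σ n) k
fall≡signPow*Q n zero = refl
fall≡signPow*Q n (suc k) = begin
  fromℕ (fall n (suc k))
    ≡⟨ cong fromℕ (fall-suc n k) ⟩
  fromℕ ((n ∸ k) ℕ.* (suc (n ℕ.+ k) ℕ.* fall n k))
    ≡⟨ fromℕ-∸-* n k (suc (n ℕ.+ k) ℕ.* fall n k)
         (λ n<k → trans (cong (suc (n ℕ.+ k) ℕ.*_) (fall-vanishes n<k)) (ℕₚ.*-zeroʳ (suc (n ℕ.+ k)))) ⟩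
  (fromℕ n - fromℕ k) * fromℕ (suc (n ℕ.+ k) ℕ.* fall n k)
    ≡⟨ cong ((fromℕ n - fromℕ k) *_) (fromℕ-* (suc (n ℕ.+ k)) (fall n k)) ⟩
  (fromℕ n - fromℕ k) * (fromℕ (suc (n ℕ.+ k)) * fromℕ (fall n k))
    ≡⟨ cong₂ (λ x y → (fromℕ n - fromℕ k) * (x * y))
             (trans (fromℕ-+ 1 (n ℕ.+ k)) (cong (λ x → 1ℚ + x) (fromℕ-+ n k))) (fall≡signPow*Q n k) ⟩
  (fromℕ n - fromℕ k) * ((1ℚ + (fromℕ n + fromℕ k)) * (signPow k * Q (σ n) k))
    ≡⟨ difference-of-pronics (fromℕ n) (fromℕ k) (signPow k) (Q (σ n) k) ⟩
  - signPow k * (Q (σ n) k * (fromℕ k * (1ℚ + fromℕ k) + - (fromℕ n * (1ℚ + fromℕ n))))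
    ≡⟨ cong₂ (λ x y → - signPow k * (Q (σ n) k * (x + - y))) (sym (fromℕ-pronic k)) (sym (fromℕ-pronic n)) ⟩
  signPow (suc k) * Q (σ n) (suc k)  ∎
  where
  open ≡-Reasoning
  difference-of-pronics : ∀ n k s q → (n - k) * ((1ℚ + (n + k)) * (s * q)) ≡ - s * (q * (k * (1ℚ + k) + - (n * (1ℚ + n))))
  difference-of-pronics = solve-∀ ℚ-ring

poch-pair : ∀ a b → a + b ≡ 1ℚ → ∀ k → poch a k * poch b k ≡ Q (a * b) k
poch-pair a b a+b≡1 zero = refl
poch-pair a b a+b≡1 (suc k) = begin
  poch a k * (a + fromℕ k) * (poch b k * (b + fromℕ k))          ≡⟨ expand (poch a k) (poch b k) a b (fromℕ k) ⟩
  poch a k * poch b k * (fromℕ k * ((a + b) + fromℕ k) + a * b)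
    ≡⟨ cong₂ (λ x y → x * (fromℕ k * (y + fromℕ k) + a * b)) (poch-pair a b a+b≡1 k) a+b≡1 ⟩
  Q (a * b) k * (fromℕ k * (1ℚ + fromℕ k) + a * b)               ≡⟨ cong (λ x → Q (a * b) k * (x + a * b)) (sym (fromℕ-pronic k)) ⟩
  Q (a * b) (suc k)                                              ∎
  where
  open ≡-Reasoning
  expand : ∀ x y a b k → x * (a + k) * (y * (b + k)) ≡ x * y * (k * ((a + b) + k) + a * b)
  expand = solve-∀ ℚ-ring

series : (ℕ → ℕ) → ℚ → ℚ → ℕ → ℚ
series j s t L = Σ< L (λ k → Q s k * recipℕ (j k !) * powℚ t k)

-- Expansions of w

module Expansion (x t α β : ℚ) (c : ℕ → ℕ → ℚ)
  (2x≡α+βt : fromℕ 2 * x ≡ α + β * t)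
  (c-00 : c 0 0 ≡ 1ℚ)
  (c-1 : 1ℚ + fromℕ 2 * x ≡ c 1 0 + c 1 1 * t)
  (c-rec : ∀ n k → c (suc (suc n)) k ≡ α * c (suc n) k + β * shift (c (suc n)) k - c n k)
  (c-vanishes : ∀ n k → n < k → c n k ≡ 0ℚ) where

  term : ℕ → ℕ → ℚ
  term n k = c n k * powℚ t k

  term-vanishes : ∀ n k → n < k → term n k ≡ 0ℚ
  term-vanishes n k n<k = trans (cong (_* powℚ t k) (c-vanishes n k n<k)) (ℚₚ.*-zeroˡ (powℚ t k))

  w-expansion : ∀ n M → n < M → w n x ≡ Σ< M (term n)
  w-expansion zero M 0<M = trans (initial (c 0 0) c-00) (sym (Σ<-extend 1 M (term 0) 0<M (term-vanishes 0)))
    where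
    initial : ∀ c₀ → c₀ ≡ 1ℚ → 1ℚ ≡ 0ℚ + c₀ * 1ℚ
    initial c₀ refl = refl
  w-expansion (suc zero) M 1<M = trans (trans c-1 (as-sum (c 1 0) (c 1 1) t)) (sym (Σ<-extend 2 M (term 1) 1<M (term-vanishes 1)))
    where
    as-sum : ∀ c₀ c₁ t → c₀ + c₁ * t ≡ 0ℚ + c₀ * 1ℚ + c₁ * (1ℚ * t)
    as-sum = solve-∀ ℚ-ring
  w-expansion (suc (suc n)) (suc M) (s≤s n+2≤M) = sym (begin
    Σ< (suc M) (term (suc (suc n)))
      ≡⟨ Σ<-cong (suc M) (λ k _ → trans (cong (_* powℚ t k) (c-rec n k)) (distribute α β (c (suc n) k) (shift (c (suc n)) k) (c n k) (powℚ t k))) ⟩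
    Σ< (suc M) (λ k → (α * term (suc n) k + β * shifted k) - term n k)
      ≡⟨ Σ<-- (suc M) (λ k → α * term (suc n) k + β * shifted k) (term n) ⟩
    Σ< (suc M) (λ k → α * term (suc n) k + β * shifted k) - Σ< (suc M) (term n)
      ≡⟨ cong (_- Σ< (suc M) (term n)) (Σ<-linear (suc M) α β (term (suc n)) shifted) ⟩
    α * Σ< (suc M) (term (suc n)) + β * Σ< (suc M) shifted - Σ< (suc M) (term n)
      ≡⟨ cong (λ s → α * Σ< (suc M) (term (suc n)) + β * s - Σ< (suc M) (term n)) (Σ<-shift M (c (suc n)) t) ⟩
    α * Σ< (suc M) (term (suc n)) + β * (t * Σ< M (term (suc n))) - Σ< (suc M) (term n)
      ≡⟨ cong₂ (λ u v → α * u + β * (t * v) - Σ< (suc M) (term n))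
           (sym (w-expansion (suc n) (suc M) (ℕₚ.m≤n⇒m≤1+n n+2≤M))) (sym (w-expansion (suc n) M n+2≤M)) ⟩
    α * w (suc n) x + β * (t * w (suc n) x) - Σ< (suc M) (term n)
      ≡⟨ cong (λ v → α * w (suc n) x + β * (t * w (suc n) x) - v)
              (sym (w-expansion n (suc M) (ℕₚ.m<n⇒m<1+n (ℕₚ.<-trans (ℕₚ.n<1+n n) n+2≤M)))) ⟩
    α * w (suc n) x + β * (t * w (suc n) x) - w n x
      ≡⟨ collect α β t (w (suc n) x) (w n x) ⟩
    (α + β * t) * w (suc n) x - w n x
      ≡⟨ cong (λ y → y * w (suc n) x - w n x) (sym 2x≡α+βt) ⟩
    fromℕ 2 * x * w (suc n) x - w n x  ∎)
    where
    open ≡-Reasoning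
    shifted : ℕ → ℚ
    shifted k = shift (c (suc n)) k * powℚ t k
    distribute : ∀ α β a b d τ → (α * a + β * b - d) * τ ≡ (α * (a * τ) + β * (b * τ)) - d * τ
    distribute = solve-∀ ℚ-ring
    collect : ∀ α β t u v → α * u + β * (t * u) - v ≡ (α + β * t) * u - v
    collect = solve-∀ ℚ-ring

yCoeff : ℕ → ℕ → ℚ
yCoeff n k = signPow k * fromℕ (oddCoeff n k)

zCoeff : ℕ → ℕ → ℚ
zCoeff n k = signPow (n ℕ.+ k) * fromℕ (evenCoeff n k)

yCoeff-rec : ∀ n k → yCoeff (suc (suc n)) k ≡ fromℕ 2 * yCoeff (suc n) k + (- 1ℚ) * shift (yCoeff (suc n)) k - yCoeff n k
yCoeff-rec n zero =
  trans (cong (1ℚ *_) (fromℕ-recurrence (oddCoeff (suc (suc n)) 0) (oddCoeff (suc n) 0) (oddCoeff n 0) 0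
                                         (oddCoeff-rec₀ n)))
        (rearrange (fromℕ 2) (fromℕ (oddCoeff (suc n) 0)) (fromℕ (oddCoeff n 0)))
  where
  rearrange : ∀ two b c → 1ℚ * (two * b + 0ℚ - c) ≡ two * (1ℚ * b) + (- 1ℚ) * 0ℚ - 1ℚ * c
  rearrange = solve-∀ ℚ-ring
yCoeff-rec n (suc k) =
  trans (cong (λ x → - signPow k * x) (fromℕ-recurrence c₂ c₁ c₀ d₁ (oddCoeff-rec n k)))
        (rearrange (signPow k) (fromℕ 2) (fromℕ c₁) (fromℕ d₁) (fromℕ c₀))
  where
  c₂ = oddCoeff (suc (suc n)) (suc k)
  c₁ = oddCoeff (suc n) (suc k)
  c₀ = oddCoeff n (suc k)
  d₁ = oddCoeff (suc n) k
  rearrange : ∀ s two b d c → - s * (two * b + d - c) ≡ two * (- s * b) + (- 1ℚ) * (s * d) - (- s * c)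
  rearrange = solve-∀ ℚ-ring

zCoeff-rec : ∀ n k → zCoeff (suc (suc n)) k ≡ (- fromℕ 2) * zCoeff (suc n) k + 1ℚ * shift (zCoeff (suc n)) k - zCoeff n k
zCoeff-rec n zero = rearrange (signPow (n ℕ.+ 0))
  where
  rearrange : ∀ s → - - s * 1ℚ ≡ (- (1ℚ + 1ℚ)) * (- s * 1ℚ) + 1ℚ * 0ℚ - s * 1ℚ
  rearrange = solve-∀ ℚ-ring
zCoeff-rec n (suc k) = begin
  - - s * fromℕ c₂                                                  ≡⟨ cong (λ x → - - s * x) (fromℕ-recurrence c₂ c₁ c₀ d₁ (evenCoeff-rec n k)) ⟩
  - - s * (fromℕ 2 * fromℕ c₁ + fromℕ d₁ - fromℕ c₀)                  ≡⟨ rearrange s (fromℕ 2) (fromℕ c₁) (fromℕ d₁) (fromℕ c₀) ⟩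
  (- fromℕ 2) * (- s * fromℕ c₁) + 1ℚ * (s * fromℕ d₁) - s * fromℕ c₀
    ≡⟨ cong (λ σ → (- fromℕ 2) * (- s * fromℕ c₁) + 1ℚ * (σ * fromℕ d₁) - s * fromℕ c₀) (cong signPow (ℕₚ.+-suc n k)) ⟩
  (- fromℕ 2) * zCoeff (suc n) (suc k) + 1ℚ * zCoeff (suc n) k - zCoeff n (suc k)  ∎
  where
  open ≡-Reasoning
  s = signPow (n ℕ.+ suc k)
  c₂ = evenCoeff (suc (suc n)) (suc k)
  c₁ = evenCoeff (suc n) (suc k)
  c₀ = evenCoeff n (suc k)
  d₁ = evenCoeff (suc n) k
  rearrange : ∀ s two b e c → - - s * (two * b + e - c) ≡ (- two) * (- s * b) + 1ℚ * (s * e) - s * c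
  rearrange = solve-∀ ℚ-ring

yCoeff-vanishes : ∀ n k → n < k → yCoeff n k ≡ 0ℚ
yCoeff-vanishes n k n<k = trans (cong (λ x → signPow k * fromℕ x) (oddCoeff-vanishes n k n<k)) (ℚₚ.*-zeroʳ (signPow k))

zCoeff-vanishes : ∀ n k → n < k → zCoeff n k ≡ 0ℚ
zCoeff-vanishes n k n<k = trans (cong (λ x → signPow (n ℕ.+ k) * fromℕ x) (evenCoeff-vanishes n k n<k)) (ℚₚ.*-zeroʳ (signPow (n ℕ.+ k)))

w-at-1-t/2 : ∀ t n M → n < M → w n (1ℚ - t * recipℕ 2) ≡ Σ< M (λ k → yCoeff n k * powℚ t k)
w-at-1-t/2 t = Expansion.w-expansion (1ℚ - t * recipℕ 2) t (fromℕ 2) (- 1ℚ) yCoeff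
  (trans (expand (fromℕ 2) (t * recipℕ 2)) (cong (λ u → fromℕ 2 + (- 1ℚ) * u) (halve t)))
  refl
  (trans (expand₁ (fromℕ 2) (t * recipℕ 2)) (cong (λ u → fromℕ 3 + (- 1ℚ) * u) (halve t)))
  yCoeff-rec yCoeff-vanishes
  where
  expand : ∀ two h → two * (1ℚ - h) ≡ two + (- 1ℚ) * (h * two)
  expand = solve-∀ ℚ-ring
  expand₁ : ∀ two h → 1ℚ + two * (1ℚ - h) ≡ (1ℚ + two) + (- 1ℚ) * (h * two)
  expand₁ = solve-∀ ℚ-ring

w-at-t/2-1 : ∀ t n M → n < M → w n (t * recipℕ 2 - 1ℚ) ≡ Σ< M (λ k → zCoeff n k * powℚ t k)
w-at-t/2-1 t = Expansion.w-expansion (t * recipℕ 2 - 1ℚ) t (- fromℕ 2) 1ℚ zCoeff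
  (trans (expand (fromℕ 2) (t * recipℕ 2)) (cong (λ u → - fromℕ 2 + 1ℚ * u) (halve t)))
  refl
  (trans (expand₁ (fromℕ 2) (t * recipℕ 2)) (cong (λ u → (1ℚ - fromℕ 2) + 1ℚ * u) (halve t)))
  zCoeff-rec zCoeff-vanishes
  where
  expand : ∀ two h → two * (h - 1ℚ) ≡ - two + 1ℚ * (h * two)
  expand = solve-∀ ℚ-ring
  expand₁ : ∀ two h → 1ℚ + two * (h - 1ℚ) ≡ (1ℚ - two) + 1ℚ * (h * two)
  expand₁ = solve-∀ ℚ-ring

yCoeff≡Q : ∀ n k → yCoeff n k ≡ fromℕ (suc (2 ℕ.* n)) * (Q (σ n) k * recipℕ ((suc (2 ℕ.* k)) !))
yCoeff≡Q n k = begin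
  signPow k * fromℕ (oddCoeff n k)
    ≡⟨ cong (signPow k *_) (fromℕ-/ (oddCoeff n k) _ ((suc (2 ℕ.* k)) !) {{suc (2 ℕ.* k) !≢0}} (oddCoeff-closed n k)) ⟩
  signPow k * (fromℕ (suc (2 ℕ.* n) ℕ.* fall n k) * r)
    ≡⟨ cong (λ x → signPow k * (x * r))
            (trans (fromℕ-* (suc (2 ℕ.* n)) (fall n k)) (cong (fromℕ (suc (2 ℕ.* n)) *_) (fall≡signPow*Q n k))) ⟩
  signPow k * (fromℕ (suc (2 ℕ.* n)) * (signPow k * Q (σ n) k) * r)
    ≡⟨ regroup (signPow k) (fromℕ (suc (2 ℕ.* n))) (Q (σ n) k) r ⟩
  (signPow k * signPow k) * (fromℕ (suc (2 ℕ.* n)) * (Q (σ n) k * r))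
    ≡⟨ cong (_* (fromℕ (suc (2 ℕ.* n)) * (Q (σ n) k * r))) (signPow-square k) ⟩
  1ℚ * (fromℕ (suc (2 ℕ.* n)) * (Q (σ n) k * r))
    ≡⟨ ℚₚ.*-identityˡ _ ⟩
  fromℕ (suc (2 ℕ.* n)) * (Q (σ n) k * r)  ∎
  where
  open ≡-Reasoning
  r = recipℕ ((suc (2 ℕ.* k)) !)
  regroup : ∀ s c q r → s * (c * (s * q) * r) ≡ (s * s) * (c * (q * r))
  regroup = solve-∀ ℚ-ring

zCoeff≡Q : ∀ n k → zCoeff n k ≡ signPow n * (Q (σ n) k * recipℕ ((2 ℕ.* k) !))
zCoeff≡Q n k = begin
  signPow (n ℕ.+ k) * fromℕ (evenCoeff n k)
    ≡⟨ cong₂ _*_ (signPow-+ n k) (fromℕ-/ (evenCoeff n k) _ ((2 ℕ.* k) !) {{2 ℕ.* k !≢0}} (C*!≡P′ (n ℕ.+ k) (2 ℕ.* k))) ⟩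
  signPow n * signPow k * (fromℕ (fall n k) * r)
    ≡⟨ cong (λ x → signPow n * signPow k * (x * r)) (fall≡signPow*Q n k) ⟩
  signPow n * signPow k * (signPow k * Q (σ n) k * r)
    ≡⟨ regroup (signPow n) (signPow k) (Q (σ n) k) r ⟩
  signPow n * ((signPow k * signPow k) * (Q (σ n) k * r))
    ≡⟨ cong (λ x → signPow n * (x * (Q (σ n) k * r))) (signPow-square k) ⟩
  signPow n * (1ℚ * (Q (σ n) k * r))
    ≡⟨ cong (signPow n *_) (ℚₚ.*-identityˡ _) ⟩
  signPow n * (Q (σ n) k * r)  ∎
  where
  open ≡-Reasoning
  r = recipℕ ((2 ℕ.* k) !)
  regroup : ∀ σ s q r → σ * s * (s * q * r) ≡ σ * ((s * s) * (q * r))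
  regroup = solve-∀ ℚ-ring

w-at-1-t/2≡series : ∀ t n M → n < M → w n (1ℚ - t * recipℕ 2) ≡ fromℕ (suc (2 ℕ.* n)) * series (λ k → suc (2 ℕ.* k)) (σ n) t M
w-at-1-t/2≡series t n M n<M = begin
  w n (1ℚ - t * recipℕ 2)
    ≡⟨ w-at-1-t/2 t n M n<M ⟩
  Σ< M (λ k → yCoeff n k * powℚ t k)
    ≡⟨ Σ<-cong M (λ k _ → trans (cong (_* powℚ t k) (yCoeff≡Q n k)) (ℚₚ.*-assoc (fromℕ (suc (2 ℕ.* n))) _ (powℚ t k))) ⟩
  Σ< M (λ k → fromℕ (suc (2 ℕ.* n)) * (Q (σ n) k * recipℕ ((suc (2 ℕ.* k)) !) * powℚ t k))
    ≡⟨ Σ<-*ˡ M (fromℕ (suc (2 ℕ.* n))) _ ⟩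
  fromℕ (suc (2 ℕ.* n)) * series (λ k → suc (2 ℕ.* k)) (σ n) t M  ∎
  where open ≡-Reasoning

w-at-t/2-1≡series : ∀ t n M → n < M → w n (t * recipℕ 2 - 1ℚ) ≡ signPow n * series (λ k → 2 ℕ.* k) (σ n) t M
w-at-t/2-1≡series t n M n<M = begin
  w n (t * recipℕ 2 - 1ℚ)
    ≡⟨ w-at-t/2-1 t n M n<M ⟩
  Σ< M (λ k → zCoeff n k * powℚ t k)
    ≡⟨ Σ<-cong M (λ k _ → trans (cong (_* powℚ t k) (zCoeff≡Q n k)) (ℚₚ.*-assoc (signPow n) _ (powℚ t k))) ⟩
  Σ< M (λ k → signPow n * (Q (σ n) k * recipℕ ((2 ℕ.* k) !) * powℚ t k))
    ≡⟨ Σ<-*ˡ M (signPow n) _ ⟩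
  signPow n * series (λ k → 2 ℕ.* k) (σ n) t M  ∎
  where open ≡-Reasoning

-- Congruences modulo p

module Modulo (p : ℕ) (p-prime : Prime p) where

  p∤1 : ¬ p ∣ 1
  p∤1 p∣1 = ℕ.nonTrivial⇒≢1 {{prime⇒nonTrivial p-prime}} (∣1⇒≡1 p∣1)

  p∤* : ∀ {a b} → ¬ p ∣ a → ¬ p ∣ b → ¬ p ∣ a ℕ.* b
  p∤* p∤a p∤b p∣ab with euclidsLemma _ _ p-prime p∣ab
  ... | inj₁ p∣a = p∤a p∣a
  ... | inj₂ p∣b = p∤b p∣b

  record Integral (x : ℚ) : Set where
    constructor integral
    field p∤denominator : ¬ p ∣ ↧ₙ x

  Divides : ℚ → Set
  Divides x = p ∣ ℤ.∣ ↥ x ∣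

  /-integral : ∀ i d .{{_ : NonZero d}} → ¬ p ∣ d → Integral (i ℚ./ d)
  /-integral i d p∤d = integral (λ p∣↧ → p∤d (∣-trans p∣↧ (divides ℤ.∣ ℤgcd i (+ d) ∣ ↧*gcd≡d)))
    where
    ↧*gcd≡d : d ≡ ℤ.∣ ℤgcd i (+ d) ∣ ℕ.* ↧ₙ (i ℚ./ d)
    ↧*gcd≡d = sym (trans (ℕₚ.*-comm _ (↧ₙ (i ℚ./ d)))
                    (trans (sym (ℤₚ.abs-* (↧ (i ℚ./ d)) (ℤgcd i (+ d)))) (cong ℤ.∣_∣ (ℚₚ.↧-/ i d))))

  /-divides : ∀ i d .{{_ : NonZero d}} → ¬ p ∣ d → p ∣ ℤ.∣ i ∣ → Divides (i ℚ./ d)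
  /-divides i d p∤d p∣i with euclidsLemma ℤ.∣ ↥ (i ℚ./ d) ∣ ℤ.∣ ℤgcd i (+ d) ∣ p-prime (subst (p ∣_) (sym ↥*gcd≡i) p∣i)
    where
    ↥*gcd≡i : ℤ.∣ ↥ (i ℚ./ d) ∣ ℕ.* ℤ.∣ ℤgcd i (+ d) ∣ ≡ ℤ.∣ i ∣
    ↥*gcd≡i = trans (sym (ℤₚ.abs-* (↥ (i ℚ./ d)) (ℤgcd i (+ d)))) (cong ℤ.∣_∣ (ℚₚ.↥-/ i d))
  ... | inj₁ p∣↥ = p∣↥
  ... | inj₂ p∣gcd = ⊥-elim (p∤d (∣-trans p∣gcd (gcd[m,n]∣n ℤ.∣ i ∣ d)))

  divides⇒integral : ∀ {x} → Divides x → Integral x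
  divides⇒integral {mkℚ n d-1 coprime} p∣n =
    integral (λ p∣d → p∤1 (subst (p ∣_) (recompute (coprime? ℤ.∣ n ∣ (suc d-1)) coprime (p∣n , p∣d)) ∣-refl))

  integral-+ : ∀ {x y} → Integral x → Integral y → Integral (x + y)
  integral-+ {x@record{}} {y@record{}} (integral p∤x) (integral p∤y) =
    /-integral (↥ x ℤ.* ↧ y ℤ.+ ↥ y ℤ.* ↧ x) (↧ₙ x ℕ.* ↧ₙ y) (p∤* p∤x p∤y)

  integral-* : ∀ {x y} → Integral x → Integral y → Integral (x * y)
  integral-* {x@record{}} {y@record{}} (integral p∤x) (integral p∤y) =
    /-integral (↥ x ℤ.* ↥ y) (↧ₙ x ℕ.* ↧ₙ y) (p∤* p∤x p∤y)

  integral-neg : ∀ {x} → Integral x → Integral (- x)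
  integral-neg {x} (integral p∤x) = integral (subst (λ d → ¬ p ∣ d) (cong ℤ.∣_∣ (sym (ℚₚ.↧-neg x))) p∤x)

  integral-- : ∀ {x y} → Integral x → Integral y → Integral (x - y)
  integral-- ix iy = integral-+ ix (integral-neg iy)

  integral-fromℕ : ∀ n → Integral (fromℕ n)
  integral-fromℕ n = /-integral (+ n) 1 p∤1

  integral-recipℕ : ∀ {d} → ¬ p ∣ d → Integral (recipℕ d)
  integral-recipℕ {zero} _ = integral-fromℕ 0
  integral-recipℕ {suc d} p∤d = /-integral (+ 1) (suc d) p∤d

  integral-powℚ : ∀ {t} k → Integral t → Integral (powℚ t k)
  integral-powℚ zero _ = integral-fromℕ 1
  integral-powℚ (suc k) it = integral-* (integral-powℚ k it) it

  integral-∏< : ∀ {f} k → (∀ j → Integral (f j)) → Integral (∏< k f)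
  integral-∏< zero _ = integral-fromℕ 1
  integral-∏< (suc k) if = integral-* (integral-∏< k if) (if k)

  divides-+ : ∀ {x y} → Divides x → Divides y → Divides (x + y)
  divides-+ {x@(mkℚ a _ _)} {y@(mkℚ b _ _)} p∣a p∣b =
    /-divides (↥ x ℤ.* ↧ y ℤ.+ ↥ y ℤ.* ↧ x) (↧ₙ x ℕ.* ↧ₙ y)
      (p∤* (Integral.p∤denominator (divides⇒integral {x} p∣a)) (Integral.p∤denominator (divides⇒integral {y} p∣b)))
      (∣⇒∣ᵤ (∣m∣n⇒∣m+n (∣m⇒∣m*n {m = a} (↧ y) (∣ᵤ⇒∣ {+ p} p∣a))
                        (∣m⇒∣m*n {m = b} (↧ x) (∣ᵤ⇒∣ {+ p} p∣b))))

  divides-* : ∀ {x y} → Divides x → Integral y → Divides (x * y)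
  divides-* {x@(mkℚ a _ _)} {y@record{}} p∣a (integral p∤y) =
    /-divides (↥ x ℤ.* ↥ y) (↧ₙ x ℕ.* ↧ₙ y) (p∤* (Integral.p∤denominator (divides⇒integral {x} p∣a)) p∤y)
      (∣⇒∣ᵤ (∣m⇒∣m*n {m = a} (↥ y) (∣ᵤ⇒∣ {+ p} p∣a)))

  divides-neg : ∀ {x} → Divides x → Divides (- x)
  divides-neg {x} p∣x = subst (p ∣_) (sym (trans (cong ℤ.∣_∣ (ℚₚ.↥-neg x)) (ℤₚ.∣-i∣≡∣i∣ (↥ x)))) p∣x

  infix 4 _≈_
  record _≈_ (x y : ℚ) : Set where
    constructor mod-p
    field ≡[modℚ] : x ≡ y [modℚ p ]

  ≡⇒≈ : ∀ {x y} → x ≡ y → x ≈ y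
  ≡⇒≈ {x} refl = mod-p (subst Divides (sym (ℚₚ.+-inverseʳ x)) (p ∣0))

  ≈-sym : ∀ {x y} → x ≈ y → y ≈ x
  ≈-sym {x} {y} (mod-p p∣x-y) = mod-p (subst Divides (flip x y) (divides-neg {x - y} p∣x-y))
    where
    flip : ∀ x y → - (x - y) ≡ y - x
    flip = solve-∀ ℚ-ring

  ≈-trans : ∀ {x y z} → x ≈ y → y ≈ z → x ≈ z
  ≈-trans {x} {y} {z} (mod-p p∣x-y) (mod-p p∣y-z) = mod-p (subst Divides (telescope x y z) (divides-+ {x - y} {y - z} p∣x-y p∣y-z))
    where
    telescope : ∀ x y z → (x - y) + (y - z) ≡ x - z
    telescope = solve-∀ ℚ-ring

  ≈-setoid : Setoid 0ℓ 0ℓ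
  ≈-setoid = record { Carrier = ℚ ; _≈_ = _≈_ ; isEquivalence = record { refl = ≡⇒≈ refl ; sym = ≈-sym ; trans = ≈-trans } }

  +-cong : ∀ {x y u v} → x ≈ y → u ≈ v → x + u ≈ y + v
  +-cong {x} {y} {u} {v} (mod-p p∣x-y) (mod-p p∣u-v) = mod-p (subst Divides (interchange x y u v) (divides-+ {x - y} {u - v} p∣x-y p∣u-v))
    where
    interchange : ∀ x y u v → (x - y) + (u - v) ≡ (x + u) - (y + v)
    interchange = solve-∀ ℚ-ring

  *-congʳ : ∀ {a x y} → Integral a → x ≈ y → x * a ≈ y * a
  *-congʳ {a} {x} {y} ia (mod-p p∣x-y) = mod-p (subst Divides (distrib x y a) (divides-* {x - y} p∣x-y ia))
    where
    distrib : ∀ x y a → (x - y) * a ≡ x * a - y * a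
    distrib = solve-∀ ℚ-ring

  *-congˡ : ∀ {a x y} → Integral a → x ≈ y → a * x ≈ a * y
  *-congˡ {a} {x} {y} ia x≈y = ≈-trans (≡⇒≈ (ℚₚ.*-comm a x)) (≈-trans (*-congʳ ia x≈y) (≡⇒≈ (ℚₚ.*-comm y a)))

  *-cong : ∀ {x y u v} → Integral y → Integral u → x ≈ y → u ≈ v → x * u ≈ y * v
  *-cong iy iu x≈y u≈v = ≈-trans (*-congʳ iu x≈y) (*-congˡ iy u≈v)

  p*integral≈0 : ∀ {y} → Integral y → fromℕ p * y ≈ 0ℚ
  p*integral≈0 {y} iy = mod-p (subst Divides (sym (ℚₚ.+-identityʳ (fromℕ p * y)))
    (divides-* {fromℕ p} (/-divides (+ p) 1 p∤1 ∣-refl) iy))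

  Σ<-cong-≈ : ∀ L {f g} → (∀ k → k < L → f k ≈ g k) → Σ< L f ≈ Σ< L g
  Σ<-cong-≈ zero _ = ≡⇒≈ refl
  Σ<-cong-≈ (suc L) f≈g = +-cong (Σ<-cong-≈ L (λ k k<L → f≈g k (ℕₚ.m≤n⇒m≤1+n k<L))) (f≈g L ℕₚ.≤-refl)

  ∏<-cong-≈ : ∀ L {f g} → (∀ j → Integral (f j)) → (∀ j → Integral (g j)) → (∀ j → f j ≈ g j) → ∏< L f ≈ ∏< L g
  ∏<-cong-≈ zero _ _ _ = ≡⇒≈ refl
  ∏<-cong-≈ (suc L) if ig f≈g = *-cong (integral-∏< L ig) (if L) (∏<-cong-≈ L if ig f≈g) (f≈g L)

  integral-factor : ∀ {s} j → Integral s → Integral (factor s j)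
  integral-factor j is = integral-+ (integral-fromℕ (j ℕ.* suc j)) is

  factor-cong : ∀ {s s′} j → s ≈ s′ → factor s j ≈ factor s′ j
  factor-cong j s≈s′ = +-cong (≡⇒≈ {fromℕ (j ℕ.* suc j)} refl) s≈s′

  integral-Q : ∀ {s} k → Integral s → Integral (Q s k)
  integral-Q k is = integral-∏< k (λ j → integral-factor j is)

  Q-cong : ∀ {s s′} k → Integral s → Integral s′ → s ≈ s′ → Q s k ≈ Q s′ k
  Q-cong k is is′ s≈s′ = ∏<-cong-≈ k (λ j → integral-factor j is) (λ j → integral-factor j is′) (λ j → factor-cong j s≈s′)

  p∤factorial : ∀ j → j < p → ¬ p ∣ j !
  p∤factorial zero _ = p∤1
  p∤factorial (suc j) j+1<p = p∤* (>⇒∤ j+1<p) (p∤factorial j (ℕₚ.<-trans (ℕₚ.n<1+n j) j+1<p))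

  factorial-p-valuation-1 : ∀ d → d < p → ∃[ u ] (p ℕ.+ d) ! ≡ p ℕ.* u × ¬ p ∣ u
  factorial-p-valuation-1 zero _ =
    ℕ.pred p ! , trans (cong _! (ℕₚ.+-identityʳ p)) (n!≡n*[n-1]! p) , p∤factorial (ℕ.pred p) (pred[n]<n p)
    where instance _ = prime⇒nonZero p-prime
  factorial-p-valuation-1 (suc d) d+1<p with factorial-p-valuation-1 d (ℕₚ.<-trans (ℕₚ.n<1+n d) d+1<p)
  ... | u , [p+d]!≡pu , p∤u = suc (p ℕ.+ d) ℕ.* u , [p+d+1]!≡ , p∤* p∤p+d+1 p∤u
    where
    [p+d+1]!≡ : (p ℕ.+ suc d) ! ≡ p ℕ.* (suc (p ℕ.+ d) ℕ.* u)
    [p+d+1]!≡ = begin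
      (p ℕ.+ suc d) !                 ≡⟨ cong _! (ℕₚ.+-suc p d) ⟩
      suc (p ℕ.+ d) ℕ.* (p ℕ.+ d) !   ≡⟨ cong (suc (p ℕ.+ d) ℕ.*_) [p+d]!≡pu ⟩
      suc (p ℕ.+ d) ℕ.* (p ℕ.* u)     ≡⟨ swap (suc (p ℕ.+ d)) p u ⟩
      p ℕ.* (suc (p ℕ.+ d) ℕ.* u)     ∎
      where
      open ≡-Reasoning
      swap : ∀ x y z → x ℕ.* (y ℕ.* z) ≡ y ℕ.* (x ℕ.* z)
      swap = ℕ-Solver.solve-∀
    p∤p+d+1 : ¬ p ∣ suc (p ℕ.+ d)
    p∤p+d+1 p∣ = >⇒∤ d+1<p (∣m+n∣m⇒∣n (subst (p ∣_) (sym (ℕₚ.+-suc p d)) p∣) ∣-refl)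

  integral-p/factorial : ∀ j → j < p ℕ.+ p → Integral (fromℕ p * recipℕ (j !))
  integral-p/factorial j j<2p with j ℕₚ.<? p
  ... | yes j<p = integral-* (integral-fromℕ p) (integral-recipℕ (p∤factorial j j<p))
  ... | no j≮p with factorial-p-valuation-1 (j ∸ p) (ℕₚ.+-cancelˡ-< p (j ∸ p) p (subst (_< p ℕ.+ p) (sym p+[j∸p]≡j) j<2p))
    where
    p+[j∸p]≡j : p ℕ.+ (j ∸ p) ≡ j
    p+[j∸p]≡j = ℕₚ.m+[n∸m]≡n (ℕₚ.≮⇒≥ j≮p)
  ...   | u , j!≡pu , p∤u = subst Integral (sym p/j!≡1/u) (integral-recipℕ p∤u)
    where
    instance
      _ = prime⇒nonZero p-prime
      _ = ℕ.≢-nonZero (λ u≡0 → p∤u (subst (p ∣_) (sym u≡0) (p ∣0)))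
    p/j!≡1/u : fromℕ p * recipℕ (j !) ≡ recipℕ u
    p/j!≡1/u = begin
      fromℕ p * recipℕ (j !)               ≡⟨ cong (λ i → fromℕ p * recipℕ (i !)) (sym (ℕₚ.m+[n∸m]≡n (ℕₚ.≮⇒≥ j≮p))) ⟩
      fromℕ p * recipℕ ((p ℕ.+ (j ∸ p)) !) ≡⟨ cong (λ x → fromℕ p * recipℕ x) j!≡pu ⟩
      fromℕ p * recipℕ (p ℕ.* u)           ≡⟨ cong (fromℕ p *_) (recipℕ-* p u) ⟩
      fromℕ p * (recipℕ p * recipℕ u)      ≡⟨ substitute-one (recipℕ-inverseˡ p) (- recipℕ u) (regroup (fromℕ p) (recipℕ p) (recipℕ u)) ⟩
      recipℕ u                             ∎
      where
      open ≡-Reasoning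
      regroup : ∀ f r u → f * (r * u) ≡ u + (1ℚ - r * f) * (- u)
      regroup = solve-∀ ℚ-ring

  integral-σ : ∀ n → Integral (σ n)
  integral-σ n = integral-neg (integral-fromℕ (n ℕ.* suc n))

  -- Used with a = 1/m, μ = m − 1, s₀ = a(1 − a); e₀ is (n(n+1) + s₀)/p.
  module Series (n N : ℕ) (a μ s₀ e₀ : ℚ)
    (n+N+1≡p : suc (n ℕ.+ N) ≡ p)
    (2n+1<p : suc (2 ℕ.* n) < p)
    (a[μ+1]≡1 : a * (μ + 1ℚ) ≡ 1ℚ)
    (ia : Integral a) (iμ : Integral μ) (ie₀ : Integral e₀)
    (s₀-split : fromℕ (n ℕ.* suc n) + s₀ ≡ fromℕ p * e₀)
    (e₀≈ : (μ + 1ℚ) * e₀ ≈ fromℕ n - fromℕ N) where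

    e₁ : ℚ
    e₁ = fromℕ n - fromℕ N

    σN-split : fromℕ (n ℕ.* suc n) + σ N ≡ fromℕ p * e₁
    σN-split = begin
      fromℕ (n ℕ.* suc n) + - fromℕ (N ℕ.* suc N)                   ≡⟨ cong₂ (λ x y → x + - y) (fromℕ-pronic n) (fromℕ-pronic N) ⟩
      fromℕ n * (1ℚ + fromℕ n) + - (fromℕ N * (1ℚ + fromℕ N))        ≡⟨ difference-of-pronics (fromℕ n) (fromℕ N) ⟩
      (1ℚ + (fromℕ n + fromℕ N)) * e₁                                ≡⟨ cong (_* e₁) (sym p≡) ⟩
      fromℕ p * e₁                                                   ∎
      where
      open ≡-Reasoning
      difference-of-pronics : ∀ x y → x * (1ℚ + x) + - (y * (1ℚ + y)) ≡ (1ℚ + (x + y)) * (x - y)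
      difference-of-pronics = solve-∀ ℚ-ring
      p≡ : fromℕ p ≡ 1ℚ + (fromℕ n + fromℕ N)
      p≡ = trans (cong fromℕ (sym n+N+1≡p)) (trans (fromℕ-+ 1 (n ℕ.+ N)) (cong (λ x → 1ℚ + x) (fromℕ-+ n N)))

    split⇒≈σn : ∀ {s e} → fromℕ (n ℕ.* suc n) + s ≡ fromℕ p * e → Integral e → s ≈ σ n
    split⇒≈σn {s} {e} split ie = begin
      s                                         ≡⟨ add-sub s (fromℕ (n ℕ.* suc n)) ⟩
      (fromℕ (n ℕ.* suc n) + s) + σ n           ≡⟨ cong (_+ σ n) split ⟩
      fromℕ p * e + σ n                         ≈⟨ +-cong (p*integral≈0 ie) (≡⇒≈ refl) ⟩
      0ℚ + σ n                                  ≡⟨ ℚₚ.+-identityˡ (σ n) ⟩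
      σ n                                       ∎
      where
      open Relation.Binary.Reasoning.Setoid ≈-setoid
      add-sub : ∀ s x → s ≡ (x + s) + - x
      add-sub = solve-∀ ℚ-ring

    integral-e₁ : Integral e₁
    integral-e₁ = integral-- (integral-fromℕ n) (integral-fromℕ N)

    integral-s₀ : Integral s₀
    integral-s₀ = subst Integral (solve-for s₀ (fromℕ (n ℕ.* suc n)) (fromℕ p * e₀) s₀-split)
                    (integral-- (integral-* (integral-fromℕ p) ie₀) (integral-fromℕ (n ℕ.* suc n)))
      where
      solve-for : ∀ s x y → x + s ≡ y → y - x ≡ s
      solve-for s x y refl = sub-add s x
        where
        sub-add : ∀ s x → (x + s) - x ≡ s
        sub-add = solve-∀ ℚ-ring

    s₀≈σN : s₀ ≈ σ N
    s₀≈σN = ≈-trans (split⇒≈σn s₀-split ie₀) (≈-sym (split⇒≈σn σN-split integral-e₁))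

    rest : ℚ → ℕ → ℚ
    rest s k = Q s n * ∏< (k ∸ suc n) (λ i → factor s (suc n ℕ.+ i))

    Q-split : ∀ s {k} → n < k → Q s k ≡ factor s n * rest s k
    Q-split s {k} n<k = begin
      Q s k                                                   ≡⟨ cong (Q s) (sym (ℕₚ.m+[n∸m]≡n n<k)) ⟩
      ∏< (suc n ℕ.+ (k ∸ suc n)) (factor s)                   ≡⟨ ∏<-split n (k ∸ suc n) (factor s) ⟩
      Q s n * factor s n * ∏< (k ∸ suc n) (λ i → factor s (suc n ℕ.+ i))
        ≡⟨ regroup (Q s n) (factor s n) (∏< (k ∸ suc n) (λ i → factor s (suc n ℕ.+ i))) ⟩
      factor s n * rest s k                                   ∎
      where
      open ≡-Reasoning
      regroup : ∀ x y z → x * y * z ≡ y * (x * z)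
      regroup = solve-∀ ℚ-ring

    integral-rest : ∀ {s} k → Integral s → Integral (rest s k)
    integral-rest k is = integral-* (integral-Q n is) (integral-∏< (k ∸ suc n) (λ i → integral-factor (suc n ℕ.+ i) is))

    rest-cong : ∀ {s s′} k → Integral s → Integral s′ → s ≈ s′ → rest s k ≈ rest s′ k
    rest-cong k is is′ s≈s′ = *-cong (integral-Q n is′) (integral-∏< (k ∸ suc n) (λ i → integral-factor (suc n ℕ.+ i) is))
      (Q-cong n is is′ s≈s′)
      (∏<-cong-≈ (k ∸ suc n) (λ i → integral-factor (suc n ℕ.+ i) is) (λ i → integral-factor (suc n ℕ.+ i) is′)
                             (λ i → factor-cong (suc n ℕ.+ i) s≈s′))

    module Term (j : ℕ → ℕ) (j≤2k+1 : ∀ k → j k ≤ suc (2 ℕ.* k)) (c : ℚ) (ic : Integral c) (c≈1 : c ≈ 1ℚ) where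
      open Relation.Binary.Reasoning.Setoid ≈-setoid

      r : ℕ → ℚ
      r k = recipℕ (j k !)

      term-≈-below : ∀ k → k ≤ n → Q s₀ k * r k ≈ a * (μ * Q (σ n) k + c * Q (σ N) k) * r k
      term-≈-below k k≤n = begin
        Q s₀ k * r k                                   ≡⟨ substitute-one a[μ+1]≡1 (Q s₀ k * r k) (expand a μ (Q s₀ k) (r k)) ⟩
        a * (μ * Q s₀ k + 1ℚ * Q s₀ k) * r k
          ≈⟨ *-congʳ ir (*-congˡ ia (+-cong (*-congˡ iμ Q₀≈Qn) (*-cong ic (integral-Q k integral-s₀) (≈-sym c≈1) Q₀≈QN))) ⟩
        a * (μ * Q (σ n) k + c * Q (σ N) k) * r k      ∎
        where
        expand : ∀ a μ q r → q * r ≡ a * (μ * q + 1ℚ * q) * r + (1ℚ - a * (μ + 1ℚ)) * (q * r)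
        expand = solve-∀ ℚ-ring
        ir : Integral (r k)
        ir = integral-recipℕ (p∤factorial (j k) (ℕₚ.≤-<-trans (ℕₚ.≤-trans (j≤2k+1 k) (s≤s (ℕₚ.*-monoʳ-≤ 2 k≤n))) 2n+1<p))
        Q₀≈Qn : Q s₀ k ≈ Q (σ n) k
        Q₀≈Qn = Q-cong k integral-s₀ (integral-σ n) (split⇒≈σn s₀-split ie₀)
        Q₀≈QN : Q s₀ k ≈ Q (σ N) k
        Q₀≈QN = Q-cong k integral-s₀ (integral-σ N) s₀≈σN

      term-≈-above : ∀ k → n < k → k < p → Q s₀ k * r k ≈ a * (μ * Q (σ n) k + c * Q (σ N) k) * r k
      term-≈-above k n<k k<p = begin
        Q s₀ k * r k                                          ≡⟨ cong (_* r k) (trans (Q-split s₀ n<k) (cong (_* X₀) s₀-split)) ⟩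
        fromℕ p * e₀ * X₀ * r k                               ≡⟨ regroup₀ (fromℕ p) e₀ X₀ (r k) ⟩
        (fromℕ p * r k) * (e₀ * X₀)                           ≈⟨ *-congˡ (integral-p/factorial (j k) j<2p) e₀X₀≈ ⟩
        (fromℕ p * r k) * (a * (c * (e₁ * X₂)))               ≡⟨ regroup₁ (fromℕ p) (r k) a μ c e₁ X₂ (rest (σ n) k) ⟩
        a * (μ * (0ℚ * rest (σ n) k) + c * (fromℕ p * e₁ * X₂)) * r k
          ≡⟨ cong₂ (λ x y → a * (μ * x + c * y) * r k) (sym Qn≡0) (sym (trans (Q-split (σ N) n<k) (cong (_* X₂) σN-split))) ⟩
        a * (μ * Q (σ n) k + c * Q (σ N) k) * r k             ∎
        where
        X₀ = rest s₀ k
        X₂ = rest (σ N) k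
        regroup₀ : ∀ p e x r → p * e * x * r ≡ (p * r) * (e * x)
        regroup₀ = solve-∀ ℚ-ring
        regroup₁ : ∀ p r a μ c e x y → (p * r) * (a * (c * (e * x))) ≡ a * (μ * (0ℚ * y) + c * (p * e * x)) * r
        regroup₁ = solve-∀ ℚ-ring
        Qn≡0 : Q (σ n) k ≡ 0ℚ * rest (σ n) k
        Qn≡0 = trans (Q-split (σ n) n<k) (cong (_* rest (σ n) k) (ℚₚ.+-inverseʳ (fromℕ (n ℕ.* suc n))))
        j<2p : j k < p ℕ.+ p
        j<2p = ℕₚ.≤-<-trans (j≤2k+1 k) (2k+1<m+m k<p)
        iX₀ : Integral X₀
        iX₀ = integral-rest k integral-s₀
        e₀X₀≈ : e₀ * X₀ ≈ a * (c * (e₁ * X₂))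
        e₀X₀≈ = begin
          e₀ * X₀                              ≡⟨ substitute-one a[μ+1]≡1 (e₀ * X₀) (expand a μ e₀ X₀) ⟩
          a * ((μ + 1ℚ) * e₀ * X₀)             ≈⟨ *-congˡ ia (*-cong integral-e₁ iX₀ e₀≈ (rest-cong k integral-s₀ (integral-σ N) s₀≈σN)) ⟩
          a * (e₁ * X₂)                        ≡⟨ cong (a *_) (sym (ℚₚ.*-identityˡ (e₁ * X₂))) ⟩
          a * (1ℚ * (e₁ * X₂))                 ≈⟨ *-congˡ ia (*-congʳ (integral-* integral-e₁ (integral-rest k (integral-σ N))) (≈-sym c≈1)) ⟩
          a * (c * (e₁ * X₂))                  ∎
          where
          expand : ∀ a μ e x → e * x ≡ a * ((μ + 1ℚ) * e * x) + (1ℚ - a * (μ + 1ℚ)) * (e * x)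
          expand = solve-∀ ℚ-ring

      term-≈ : ∀ k → k < p → Q s₀ k * r k ≈ a * (μ * Q (σ n) k + c * Q (σ N) k) * r k
      term-≈ k k<p with k ℕₚ.≤? n
      ... | yes k≤n = term-≈-below k k≤n
      ... | no k≰n = term-≈-above k (ℕₚ.≰⇒> k≰n) k<p

      series-≈ : ∀ {t} → Integral t → series j s₀ t p ≈ a * (μ * series j (σ n) t p + c * series j (σ N) t p)
      series-≈ {t} it = begin
        series j s₀ t p
          ≈⟨ Σ<-cong-≈ p (λ k k<p → *-congʳ (integral-powℚ k it) (term-≈ k k<p)) ⟩
        Σ< p (λ k → a * (μ * Q (σ n) k + c * Q (σ N) k) * r k * powℚ t k)
          ≡⟨ Σ<-cong p (λ k _ → distribute a μ c (Q (σ n) k) (Q (σ N) k) (r k) (powℚ t k)) ⟩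
        Σ< p (λ k → (a * μ) * (Q (σ n) k * r k * powℚ t k) + (a * c) * (Q (σ N) k * r k * powℚ t k))
          ≡⟨ Σ<-linear p (a * μ) (a * c) _ _ ⟩
        (a * μ) * series j (σ n) t p + (a * c) * series j (σ N) t p
          ≡⟨ collect a μ c (series j (σ n) t p) (series j (σ N) t p) ⟩
        a * (μ * series j (σ n) t p + c * series j (σ N) t p)  ∎
        where
        distribute : ∀ a μ c x y r τ → a * (μ * x + c * y) * r * τ ≡ (a * μ) * (x * r * τ) + (a * c) * (y * r * τ)
        distribute = solve-∀ ℚ-ring
        collect : ∀ a μ c x y → (a * μ) * x + (a * c) * y ≡ a * (μ * x + c * y)
        collect = solve-∀ ℚ-ring

module Congruences (m : ℕ) .{{_ : NonZero m}} (3≤m : 3 ≤ m) (p : ℕ) (p-prime : Prime p) (p-odd : p % 2 ≡ 1)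
  (p∤m : ¬ p ∣ m) (residue : p % m ≡ 1 ⊎ p % m ≡ m ∸ 1) where
  open Modulo p p-prime

  n N : ℕ
  n = p ℕ./ m
  N = ((m ∸ 1) ℕ.* p) ℕ./ m

  a b μ : ℚ
  a = (+ 1) ℚ./ m
  b = (+ (m ∸ 1)) ℚ./ m
  μ = fromℕ (m ∸ 1)

  M X R : ℚ
  M = fromℕ m
  X = fromℕ n
  R = fromℕ (p % m)

  μ+1≡M : μ + 1ℚ ≡ M
  μ+1≡M = trans (sym (fromℕ-+ (m ∸ 1) 1)) (cong fromℕ (ℕₚ.m∸n+n≡m (ℕₚ.≤-trans (s≤s z≤n) 3≤m)))

  a≡ : a ≡ recipℕ m
  a≡ = trans (/≡fromℕ*recipℕ 1 m) (ℚₚ.*-identityˡ (recipℕ m))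

  b≡ : b ≡ μ * a
  b≡ = trans (/≡fromℕ*recipℕ (m ∸ 1) m) (cong (μ *_) (sym a≡))

  aM≡1 : a * M ≡ 1ℚ
  aM≡1 = trans (cong (_* M) a≡) (recipℕ-inverseˡ m)

  a[μ+1]≡1 : a * (μ + 1ℚ) ≡ 1ℚ
  a[μ+1]≡1 = trans (cong (a *_) μ+1≡M) aM≡1

  a+b≡1 : a + b ≡ 1ℚ
  a+b≡1 = begin
    a + b              ≡⟨ cong (λ x → a + x) b≡ ⟩
    a + μ * a          ≡⟨ factor-out a μ ⟩
    a * (μ + 1ℚ)       ≡⟨ a[μ+1]≡1 ⟩
    1ℚ                 ∎
    where
    open ≡-Reasoning
    factor-out : ∀ a μ → a + μ * a ≡ a * (μ + 1ℚ)
    factor-out = solve-∀ ℚ-ring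

  r≢0 : ¬ p % m ≡ 0
  r≢0 r≡0 = [ (λ r≡1 → ℕₚ.0≢1+n (trans (sym r≡0) r≡1))
            , (λ r≡m-1 → ℕₚ.<⇒≢ (ℕₚ.≤-trans (s≤s z≤n) (ℕₚ.∸-monoˡ-≤ 1 3≤m)) (trans (sym r≡0) r≡m-1)) ]′ residue

  R-relation : (R - 1ℚ) * (R + 1ℚ - M) ≡ 0ℚ
  R-relation = [ (λ r≡1 → trans (cong (λ r → (fromℕ r - 1ℚ) * (fromℕ r + 1ℚ - M)) r≡1) (first-factor M))
               , (λ r≡m-1 → trans (cong (λ r → (fromℕ r - 1ℚ) * (fromℕ r + 1ℚ - M)) r≡m-1)
                                   (trans (cong (λ x → (μ - 1ℚ) * (x - M)) μ+1≡M) (second-factor μ M))) ]′ residue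
    where
    first-factor : ∀ M → (1ℚ - 1ℚ) * (1ℚ + 1ℚ - M) ≡ 0ℚ
    first-factor = solve-∀ ℚ-ring
    second-factor : ∀ μ M → (μ - 1ℚ) * (M - M) ≡ 0ℚ
    second-factor = solve-∀ ℚ-ring

  n+N+1≡p : suc (n ℕ.+ N) ≡ p
  n+N+1≡p = floor-sum p m r≢0

  2n+1<p : suc (2 ℕ.* n) < p
  2n+1<p = 2[p/m]+1<p p m 3≤m (ℕ.nonTrivial⇒n>1 p {{prime⇒nonTrivial p-prime}}) r≢0

  P≡R+XM : fromℕ p ≡ R + X * M
  P≡R+XM = trans (cong fromℕ (m≡m%n+[m/n]*n p m)) (trans (fromℕ-+ (p % m) (n ℕ.* m)) (cong (λ x → R + x) (fromℕ-* n m)))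

  N≡P-X-1 : fromℕ N ≡ (R + X * M) - X - 1ℚ
  N≡P-X-1 = begin
    fromℕ N                               ≡⟨ solve-for (fromℕ N) X ⟩
    (1ℚ + (X + fromℕ N)) - X - 1ℚ         ≡⟨ cong (λ x → x - X - 1ℚ) (sym (trans (fromℕ-+ 1 (n ℕ.+ N)) (cong (λ x → 1ℚ + x) (fromℕ-+ n N)))) ⟩
    fromℕ (suc (n ℕ.+ N)) - X - 1ℚ         ≡⟨ cong (λ x → fromℕ x - X - 1ℚ) n+N+1≡p ⟩
    fromℕ p - X - 1ℚ                      ≡⟨ cong (λ x → x - X - 1ℚ) P≡R+XM ⟩
    (R + X * M) - X - 1ℚ                  ∎
    where
    open ≡-Reasoning
    solve-for : ∀ y x → y ≡ (1ℚ + (x + y)) - x - 1ℚ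
    solve-for = solve-∀ ℚ-ring

  -- (n(n+1) + ab)/p in closed form, valid because (r − 1)(r + 1 − m) = 0 for r = p % m.
  e₀ : ℚ
  e₀ = (R + X * M + M - (R + R)) * a * a

  ia : Integral a
  ia = subst Integral (sym a≡) (integral-recipℕ p∤m)

  ie₀ : Integral e₀
  ie₀ = integral-* (integral-* (integral-- (integral-+ (integral-+ iR (integral-* (integral-fromℕ n) iM)) iM) (integral-+ iR iR)) ia) ia
    where
    iR = integral-fromℕ (p % m)
    iM = integral-fromℕ m

  s₀-split : fromℕ (n ℕ.* suc n) + a * b ≡ fromℕ p * e₀
  s₀-split = begin
    fromℕ (n ℕ.* suc n) + a * b                 ≡⟨ cong₂ (λ x y → x + a * y) (fromℕ-pronic n) (trans b≡ (cong (_* a) μ≡M-1)) ⟩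
    X * (1ℚ + X) + a * ((M - 1ℚ) * a)
      ≡⟨ substitute-one aM≡1 ((1ℚ + a * M) * (X * (1ℚ + X))) (substitute-zero R-relation (a * a) (expand a M X R)) ⟩
    (R + X * M) * e₀                            ≡⟨ cong (_* e₀) (sym P≡R+XM) ⟩
    fromℕ p * e₀                                ∎
    where
    open ≡-Reasoning
    μ≡M-1 : μ ≡ M - 1ℚ
    μ≡M-1 = trans (add-sub μ) (cong (_- 1ℚ) μ+1≡M)
      where
      add-sub : ∀ x → x ≡ (x + 1ℚ) - 1ℚ
      add-sub = solve-∀ ℚ-ring
    expand : ∀ a M X R → X * (1ℚ + X) + a * ((M - 1ℚ) * a)
      ≡ ((R + X * M) * ((R + X * M + M - (R + R)) * a * a) + (1ℚ - a * M) * ((1ℚ + a * M) * (X * (1ℚ + X)))) + (R - 1ℚ) * (R + 1ℚ - M) * (a * a)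
    expand = solve-∀ ℚ-ring

  e₀≈ : (μ + 1ℚ) * e₀ ≈ X - fromℕ N
  e₀≈ = begin
    (μ + 1ℚ) * e₀
      ≡⟨ cong (_* e₀) μ+1≡M ⟩
    M * e₀
      ≡⟨ substitute-one aM≡1 (R - 1ℚ - (X + X) + M * X + a * R - a * M - a * M * X) (expand a M X R) ⟩
    (X - ((R + X * M) - X - 1ℚ)) + (R + X * M) * ((M - 1ℚ) * a)
      ≡⟨ cong₂ (λ y P → (X - y) + P * ((M - 1ℚ) * a)) (sym N≡P-X-1) (sym P≡R+XM) ⟩
    (X - fromℕ N) + fromℕ p * ((M - 1ℚ) * a)
      ≈⟨ +-cong (≡⇒≈ {X - fromℕ N} refl) (p*integral≈0 (integral-* (integral-- (integral-fromℕ m) (integral-fromℕ 1)) ia)) ⟩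
    (X - fromℕ N) + 0ℚ
      ≡⟨ ℚₚ.+-identityʳ (X - fromℕ N) ⟩
    X - fromℕ N  ∎
    where
    open Relation.Binary.Reasoning.Setoid ≈-setoid
    expand : ∀ a M X R → M * ((R + X * M + M - (R + R)) * a * a)
      ≡ ((X - ((R + X * M) - X - 1ℚ)) + (R + X * M) * ((M - 1ℚ) * a)) + (1ℚ - a * M) * (R - 1ℚ - (X + X) + M * X + a * R - a * M - a * M * X)
    expand = solve-∀ ℚ-ring

  open Series n N a μ (a * b) e₀ n+N+1≡p 2n+1<p a[μ+1]≡1 ia (integral-fromℕ (m ∸ 1)) ie₀ s₀-split e₀≈

  n<p : n < p
  n<p = subst (n <_) n+N+1≡p (s≤s (ℕₚ.m≤m+n n N))

  N<p : N < p
  N<p = subst (N <_) n+N+1≡p (s≤s (ℕₚ.m≤n+m N n))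

  series-of-poch : ∀ j t → Σ< p (λ k → poch a k * poch b k * recipℕ (j k !) * powℚ t k) ≡ series j (a * b) t p
  series-of-poch j t = Σ<-cong p (λ k _ → cong (λ x → x * recipℕ (j k !) * powℚ t k) (poch-pair a b a+b≡1 k))

  ρ f₁ f₂ c₁ : ℚ
  ρ = recipℕ (suc (2 ℕ.* n))
  f₁ = fromℕ (suc (2 ℕ.* n))
  f₂ = fromℕ (suc (2 ℕ.* N))
  c₁ = - (f₂ * ρ)

  ρf₁≡1 : ρ * f₁ ≡ 1ℚ
  ρf₁≡1 = recipℕ-inverseˡ (suc (2 ℕ.* n))

  ic₁ : Integral c₁
  ic₁ = integral-neg (integral-* (integral-fromℕ (suc (2 ℕ.* N))) (integral-recipℕ (>⇒∤ 2n+1<p)))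

  f₂+f₁≡2p : f₂ + f₁ ≡ fromℕ p * fromℕ 2
  f₂+f₁≡2p = begin
    f₂ + f₁                                      ≡⟨ sym (fromℕ-+ (suc (2 ℕ.* N)) (suc (2 ℕ.* n))) ⟩
    fromℕ (suc (2 ℕ.* N) ℕ.+ suc (2 ℕ.* n))      ≡⟨ cong fromℕ (trans (double n N) (cong (ℕ._* 2) n+N+1≡p)) ⟩
    fromℕ (p ℕ.* 2)                              ≡⟨ fromℕ-* p 2 ⟩
    fromℕ p * fromℕ 2                            ∎
    where
    open ≡-Reasoning
    double : ∀ n N → suc (2 ℕ.* N) ℕ.+ suc (2 ℕ.* n) ≡ suc (n ℕ.+ N) ℕ.* 2
    double = ℕ-Solver.solve-∀

  c₁≈1 : c₁ ≈ 1ℚ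
  c₁≈1 = begin
    - (f₂ * ρ)                          ≡⟨ substitute-one ρf₁≡1 (- 1ℚ) (expand f₂ f₁ ρ) ⟩
    1ℚ + (f₂ + f₁) * (- ρ)              ≡⟨ cong (λ x → 1ℚ + x * (- ρ)) f₂+f₁≡2p ⟩
    1ℚ + fromℕ p * fromℕ 2 * (- ρ)      ≡⟨ cong (λ x → 1ℚ + x) (ℚₚ.*-assoc (fromℕ p) (fromℕ 2) (- ρ)) ⟩
    1ℚ + fromℕ p * (fromℕ 2 * (- ρ))
      ≈⟨ +-cong (≡⇒≈ {1ℚ} refl) (p*integral≈0 (integral-* (integral-fromℕ 2) (integral-neg (integral-recipℕ (>⇒∤ 2n+1<p))))) ⟩
    1ℚ + 0ℚ                             ≡⟨⟩
    1ℚ                                  ∎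
    where
    open Relation.Binary.Reasoning.Setoid ≈-setoid
    expand : ∀ f₂ f₁ ρ → - (f₂ * ρ) ≡ (1ℚ + (f₂ + f₁) * (- ρ)) + (1ℚ - ρ * f₁) * (- 1ℚ)
    expand = solve-∀ ℚ-ring

  first-congruence : ∀ t → InDp p t →
    Σ< p (λ k → poch a k * poch b k * recipℕ ((2 ℕ.* k ℕ.+ 1) !) * powℚ t k)
      ≡ recipℕ (m ℕ.* (1 ℕ.+ 2 ℕ.* n)) * (μ * w n (1ℚ - t * recipℕ 2) - w N (1ℚ - t * recipℕ 2)) [modℚ p ]
  first-congruence t t∈Dₚ = _≈_.≡[modℚ] (begin
    Σ< p (λ k → poch a k * poch b k * recipℕ ((2 ℕ.* k ℕ.+ 1) !) * powℚ t k)
      ≡⟨ Σ<-cong p (λ k _ → cong (λ i → poch a k * poch b k * recipℕ (i !) * powℚ t k) (ℕₚ.+-comm (2 ℕ.* k) 1)) ⟩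
    Σ< p (λ k → poch a k * poch b k * recipℕ (odd k !) * powℚ t k)
      ≡⟨ series-of-poch odd t ⟩
    series odd (a * b) t p
      ≈⟨ Term.series-≈ odd (λ _ → ℕₚ.≤-refl) c₁ ic₁ c₁≈1 (integral t∈Dₚ) ⟩
    a * (μ * S n + c₁ * S N)
      ≡⟨ substitute-one ρf₁≡1 (- (a * μ * S n)) (expand a ρ μ f₁ f₂ (S n) (S N)) ⟨
    a * ρ * (μ * (f₁ * S n) - f₂ * S N)
      ≡⟨ cong₂ (λ r v → r * ρ * v) (sym a≡) (cong₂ (λ u v → μ * u - v) (w-at-1-t/2≡series t n p n<p) (w-at-1-t/2≡series t N p N<p)) ⟨
    recipℕ m * ρ * (μ * w n y - w N y)
      ≡⟨ cong (_* (μ * w n y - w N y)) (recipℕ-* m (suc (2 ℕ.* n))) ⟨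
    recipℕ (m ℕ.* (1 ℕ.+ 2 ℕ.* n)) * (μ * w n y - w N y)  ∎)
    where
    open Relation.Binary.Reasoning.Setoid ≈-setoid
    odd : ℕ → ℕ
    odd k = suc (2 ℕ.* k)
    S : ℕ → ℚ
    S i = series odd (σ i) t p
    y = 1ℚ - t * recipℕ 2
    expand : ∀ a ρ μ f₁ f₂ x z → a * ρ * (μ * (f₁ * x) - f₂ * z) ≡ a * (μ * x + (- (f₂ * ρ)) * z) + (1ℚ - ρ * f₁) * (- (a * μ * x))
    expand = solve-∀ ℚ-ring

  signPow-n+N : signPow n * signPow N ≡ 1ℚ
  signPow-n+N = begin
    signPow n * signPow N                  ≡⟨ sym (signPow-+ n N) ⟩
    signPow (n ℕ.+ N)                      ≡⟨ cong signPow (ℕₚ.suc-injective (trans n+N+1≡p p≡)) ⟩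
    signPow (p ℕ./ 2 ℕ.* 2)                ≡⟨ cong signPow (double (p ℕ./ 2)) ⟩
    signPow (p ℕ./ 2 ℕ.+ p ℕ./ 2)          ≡⟨ signPow-even (p ℕ./ 2) ⟩
    1ℚ                                     ∎
    where
    open ≡-Reasoning
    p≡ : p ≡ suc (p ℕ./ 2 ℕ.* 2)
    p≡ = trans (m≡m%n+[m/n]*n p 2) (cong (ℕ._+ p ℕ./ 2 ℕ.* 2) p-odd)
    double : ∀ q → q ℕ.* 2 ≡ q ℕ.+ q
    double = ℕ-Solver.solve-∀

  second-congruence : ∀ t → InDp p t →
    Σ< p (λ k → poch a k * poch b k * recipℕ ((2 ℕ.* k) !) * powℚ t k)
      ≡ signPow n * recipℕ m * (μ * w n (t * recipℕ 2 - 1ℚ) + w N (t * recipℕ 2 - 1ℚ)) [modℚ p ]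
  second-congruence t t∈Dₚ = _≈_.≡[modℚ] (begin
    Σ< p (λ k → poch a k * poch b k * recipℕ ((2 ℕ.* k) !) * powℚ t k)
      ≡⟨ series-of-poch even t ⟩
    series even (a * b) t p
      ≈⟨ Term.series-≈ even (λ k → ℕₚ.n≤1+n (2 ℕ.* k)) 1ℚ (integral-fromℕ 1) (≡⇒≈ refl) (integral t∈Dₚ) ⟩
    a * (μ * S n + 1ℚ * S N)
      ≡⟨ substitute-one (signPow-square n) (- (a * μ * S n))
           (substitute-one signPow-n+N (- (a * S N)) (expand a μ (signPow n) (signPow N) (S n) (S N))) ⟨
    signPow n * a * (μ * (signPow n * S n) + signPow N * S N)
      ≡⟨ cong₂ (λ r v → signPow n * r * v) (sym a≡) (cong₂ (λ u v → μ * u + v) (w-at-t/2-1≡series t n p n<p) (w-at-t/2-1≡series t N p N<p)) ⟨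
    signPow n * recipℕ m * (μ * w n z + w N z)  ∎)
    where
    open Relation.Binary.Reasoning.Setoid ≈-setoid
    even : ℕ → ℕ
    even k = 2 ℕ.* k
    S : ℕ → ℚ
    S i = series even (σ i) t p
    z = t * recipℕ 2 - 1ℚ
    expand : ∀ a μ s σ x u → s * a * (μ * (s * x) + σ * u)
                           ≡ (a * (μ * x + 1ℚ * u) + (1ℚ - s * s) * (- (a * μ * x))) + (1ℚ - s * σ) * (- (a * u))
    expand = solve-∀ ℚ-ring

module PrimeAbove3 {p : ℕ} (p-prime : Prime p) (3<p : 3 < p) where
  open Modulo p p-prime using (p∤*)

  2<p : 2 < p
  2<p = ℕₚ.<-trans (ℕₚ.n<1+n 2) 3<p

  prime⇒∤ : ∀ d .{{_ : ℕ.NonTrivial d}} → d < p → ¬ d ∣ p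
  prime⇒∤ d d<p d∣p = Prime.notComposite p-prime (composite d<p d∣p)

  p-odd : p % 2 ≡ 1
  p-odd with p % 2 | m%n<n p 2 | (λ (r≡0 : p % 2 ≡ 0) → prime⇒∤ 2 2<p (m%n≡0⇒n∣m p 2 r≡0))
  ... | 0 | _ | 2∤p = ⊥-elim (2∤p refl)
  ... | 1 | _ | _ = refl
  ... | suc (suc _) | s≤s (s≤s ()) | _

  2∤p%m : ∀ m .{{_ : NonZero m}} → 2 ∣ m → ¬ 2 ∣ p % m
  2∤p%m m 2∣m 2∣r = prime⇒∤ 2 2<p (∣n∣m%n⇒∣m 2∣m 2∣r)

  3∤p%m : ∀ m .{{_ : NonZero m}} → 3 ∣ m → ¬ 3 ∣ p % m
  3∤p%m m 3∣m 3∣r = prime⇒∤ 3 3<p (∣n∣m%n⇒∣m 3∣m 3∣r)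

  residue : ∀ m .{{_ : NonZero m}} → m ≡ 3 ⊎ m ≡ 4 ⊎ m ≡ 6 → p % m ≡ 1 ⊎ p % m ≡ m ∸ 1
  residue .3 (inj₁ refl) with p % 3 | m%n<n p 3 | 3∤p%m 3 ∣-refl
  ... | 0 | _ | 3∤r = ⊥-elim (3∤r (3 ∣0))
  ... | 1 | _ | _ = inj₁ refl
  ... | 2 | _ | _ = inj₂ refl
  ... | suc (suc (suc _)) | s≤s (s≤s (s≤s ())) | _
  residue .4 (inj₂ (inj₁ refl)) with p % 4 | m%n<n p 4 | 2∤p%m 4 (divides 2 refl)
  ... | 0 | _ | 2∤r = ⊥-elim (2∤r (2 ∣0))
  ... | 1 | _ | _ = inj₁ refl
  ... | 2 | _ | 2∤r = ⊥-elim (2∤r ∣-refl)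
  ... | 3 | _ | _ = inj₂ refl
  ... | suc (suc (suc (suc _))) | s≤s (s≤s (s≤s (s≤s ()))) | _
  residue .6 (inj₂ (inj₂ refl)) with p % 6 | m%n<n p 6 | 2∤p%m 6 (divides 3 refl) | 3∤p%m 6 (divides 2 refl)
  ... | 0 | _ | 2∤r | _ = ⊥-elim (2∤r (2 ∣0))
  ... | 1 | _ | _ | _ = inj₁ refl
  ... | 2 | _ | 2∤r | _ = ⊥-elim (2∤r ∣-refl)
  ... | 3 | _ | _ | 3∤r = ⊥-elim (3∤r ∣-refl)
  ... | 4 | _ | 2∤r | _ = ⊥-elim (2∤r (divides 2 refl))
  ... | 5 | _ | _ | _ = inj₂ refl
  ... | suc (suc (suc (suc (suc (suc _))))) | s≤s (s≤s (s≤s (s≤s (s≤s (s≤s ()))))) | _ | _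

  p∤m : ∀ m → m ≡ 3 ⊎ m ≡ 4 ⊎ m ≡ 6 → ¬ p ∣ m
  p∤m .3 (inj₁ refl) = >⇒∤ 3<p
  p∤m .4 (inj₂ (inj₁ refl)) = p∤* (>⇒∤ 2<p) (>⇒∤ 2<p)
  p∤m .6 (inj₂ (inj₂ refl)) = p∤* (>⇒∤ 2<p) (>⇒∤ 3<p)

3≤m : ∀ {m} → m ≡ 3 ⊎ m ≡ 4 ⊎ m ≡ 6 → 3 ≤ m
3≤m (inj₁ refl) = ℕₚ.≤-refl
3≤m (inj₂ (inj₁ refl)) = ℕₚ.n≤1+n 3
3≤m (inj₂ (inj₂ refl)) = s≤s (s≤s (s≤s z≤n))

corollary2 : (m : ℕ) .{{_ : NonZero m}} → (m ≡ 3 ⊎ m ≡ 4 ⊎ m ≡ 6) →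
    (p : ℕ) → Prime p → p > 3 → (t : ℚ) → InDp p t →
    (Σ< p (λ k → poch ((+ 1) ℚ./ m) k * poch ((+ (m ∸ 1)) ℚ./ m) k * recipℕ ((2 ℕ.* k ℕ.+ 1) !) * powℚ t k)
      ≡ recipℕ (m ℕ.* (1 ℕ.+ 2 ℕ.* (p ℕ./ m)))
        * (fromℕ (m ∸ 1) * w (p ℕ./ m) (ℚ.1ℚ - t * recipℕ 2) - w (((m ∸ 1) ℕ.* p) ℕ./ m) (ℚ.1ℚ - t * recipℕ 2))
      [modℚ p ])
    ×
    (Σ< p (λ k → poch ((+ 1) ℚ./ m) k * poch ((+ (m ∸ 1)) ℚ./ m) k * recipℕ ((2 ℕ.* k) !) * powℚ t k)
      ≡ signPow (p ℕ./ m) * recipℕ m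
        * (fromℕ (m ∸ 1) * w (p ℕ./ m) (t * recipℕ 2 - ℚ.1ℚ) + w (((m ∸ 1) ℕ.* p) ℕ./ m) (t * recipℕ 2 - ℚ.1ℚ))
      [modℚ p ])
corollary2 m m∈346 p p-prime 3<p t t∈Dₚ = first-congruence t t∈Dₚ , second-congruence t t∈Dₚ
  where
  open PrimeAbove3 p-prime 3<p
  open Congruences m (3≤m m∈346) p p-prime p-odd (p∤m m m∈346) (residue m m∈346)
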